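{- Let $m_1,m_2\geq 3$, $k\geq 1$ and $n=m_1+m_2+k-2$, and suppose the graph $C^n_{m_1,m_2}$ has girth at least $k$. Then $F(L_{n,n-k})<F(C^n_{m_1,m_2})$.
   Context: $F(G)$ is the number of connected subgraphs of $G$ (nonempty connected subgraphs, i.e. vertex subsets with subsets of edges among them; distinct subgraphs counted separately). For $m_1,m_2\geq 3$ and $n\geq m_1+m_2$, $C^n_{m_1,m_2}$ is obtained by identifying one end vertex of the path $P_{n+2-(m_1+m_2)}$ with a vertex of the cycle $C_{m_1}$ and the other end vertex with a vertex of the cycle $C_{m_2}$; for $n=m_1+m_2-1$ it is obtained by identifying a vertex of $C_{m_1}$ with a vertex of $C_{m_2}$. It has $n$ vertices and $n+2-(m_1+m_2)$ cut vertices (here $k$). $L_{n,n-k}$ is obtained by identifying an end vertex of the path $P_{k+1}$ with a vertex of the cycle $C_{n-k}$. -}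

module Defs where

open import Data.Nat using (ℕ; zero; suc; _+_; _∸_; _≤_)
open import Data.Bool using (Bool; true; false)
open import Data.Fin using (Fin)
open import Data.Product using (Σ; _×_; _,_)
open import Data.Sum using (_⊎_)
open import Data.List using (List; []; _∷_; _++_; length; lookup; upTo; applyUpTo; map; take)
open import Data.List.Membership.Propositional using (_∈_)
open import Data.List.Relation.Unary.Linked using (Linked)
open import Data.List.Relation.Unary.Unique.Propositional using (Unique)
open import Data.Vec using (Vec; []; _∷_)
import Data.Vec as Vec
open import Function.Bundles using (_↔_)
open import Relation.Binary.PropositionalEquality using (_≡_)

-- Finite simple graphs: vertex set {0,…,n-1}, edges listed as pairs
-- (each edge listed once, in one orientation).

record Graph : Set where
  constructor graph
  field
    nV    : ℕ
    edges : List (ℕ × ℕ)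
open Graph public

Adj : Graph → ℕ → ℕ → Set
Adj G u v = ((u , v) ∈ edges G) ⊎ ((v , u) ∈ edges G)

pathEdges : List ℕ → List (ℕ × ℕ)
pathEdges []            = []
pathEdges (x ∷ [])      = []
pathEdges (x ∷ y ∷ vs)  = (x , y) ∷ pathEdges (y ∷ vs)

cycleEdges : List ℕ → List (ℕ × ℕ)
cycleEdges []       = []
cycleEdges (x ∷ vs) = pathEdges ((x ∷ vs) ++ (x ∷ []))

-- the far end vertex of the path P_k in C^n_{m1,m2}: its vertices are
-- 0, m1, m1+1, …, m1+k-2 (just 0 when k = 1)
pathEnd : ℕ → ℕ → ℕ
pathEnd m1 zero          = 0
pathEnd m1 (suc zero)    = 0
pathEnd m1 (suc (suc j)) = m1 + j

-- C^n_{m1,m2} with n = m1 + m2 + k - 2 (k = number of path vertices):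
--   C_{m1} on 0 … m1-1;
--   P_k on 0, m1, …, m1+k-2  (one end identified with vertex 0 of C_{m1});
--   C_{m2} on pathEnd, m1+k-1, …, m1+k+m2-3 (other end identified with C_{m2}).
-- For k = 1 this is C_{m1} and C_{m2} glued at vertex 0.
Cmm : ℕ → ℕ → ℕ → Graph
Cmm m1 m2 k = graph (m1 + m2 + k ∸ 2)
  ( cycleEdges (upTo m1)
  ++ pathEdges (0 ∷ applyUpTo (m1 +_) (k ∸ 1))
  ++ cycleEdges (pathEnd m1 k ∷ applyUpTo ((m1 + k ∸ 1) +_) (m2 ∸ 1)))

-- L_{n,n-k}: C_{n-k} on 0 … n-k-1, and the path P_{k+1} on
-- 0, n-k, n-k+1, …, n-1 (end vertex identified with vertex 0 of the cycle).
Lnk : ℕ → ℕ → Graph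
Lnk n k = graph n
  ( cycleEdges (upTo (n ∸ k))
  ++ pathEdges (0 ∷ applyUpTo ((n ∸ k) +_) k))

record IsCycle (G : Graph) (vs : List ℕ) : Set where
  field
    long     : 3 ≤ length vs
    distinct : Unique vs
    closed   : Linked (Adj G) (vs ++ take 1 vs)

GirthAtLeast : Graph → ℕ → Set
GirthAtLeast G g = ∀ vs → IsCycle G vs → g ≤ length vs

memb : ∀ {n} → Vec Bool n → ℕ → Bool
memb []      _       = false
memb (b ∷ S) zero    = b
memb (b ∷ S) (suc v) = memb S v

module _ (G : Graph) where
  private
    E = edges G

  EdgeSel : Set
  EdgeSel = Vec Bool (length E)

  SelAdj : EdgeSel → ℕ → ℕ → Set
  SelAdj T u w = Σ (Fin (length E)) λ j →
    (Vec.lookup T j ≡ true) × ((lookup E j ≡ (u , w)) ⊎ (lookup E j ≡ (w , u)))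

  data Walk (T : EdgeSel) : ℕ → ℕ → Set where
    here : ∀ {u} → Walk T u u
    step : ∀ {u w v} → SelAdj T u w → Walk T w v → Walk T u v

  -- The propositional
  -- conditions are irrelevant fields, so a subgraph is determined by (S , T).
  record ConnSub : Set where
    constructor connSub
    field
      vset      : Vec Bool (nV G)
      eset      : EdgeSel
      .nonempty : Σ (Fin (nV G)) λ i → Vec.lookup vset i ≡ true
      .inside   : ∀ j → Vec.lookup eset j ≡ true →
                  (memb vset (Data.Product.proj₁ (lookup E j)) ≡ true) ×
                  (memb vset (Data.Product.proj₂ (lookup E j)) ≡ true)
      .conn     : ∀ u v → memb vset u ≡ true → memb vset v ≡ true → Walk eset u v

-- F(G) = N : the connected subgraphs of G are in bijection with Fin N
HasF : Graph → ℕ → Set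
HasF G N = Fin N ↔ ConnSub G

-- Both graphs have a Hamiltonian path 0 — 1 — ⋯ — (n-1). Relabelled along it, L_{n,n-k} is this path
-- plus the chord (c, 0) with c = n-k-1, and C^n_{m₁,m₂} is the path plus the chords (m₁-1, 0) and
-- (n-1, n-m₂). Connected subgraphs avoiding the (first) chord live on the common path and correspond
-- identically. A connected subgraph of L through its chord is its cycle minus one run of consecutive
-- edges (a gap) together with an initial segment of the tail, so there are (1 + C(n-k,2))(k+1) of them.
-- On the side of C it suffices to exhibit distinct ones: a gap in the first cycle together with either
-- an initial segment of the rest of the path, or the whole path, the second chord and a gap in the
-- second cycle; these are (1 + C(m₁,2))(n-m₁+1 + 1 + C(m₂,2)) subgraphs. The girth hypothesis gives
-- k ≤ m₁, which makes the second number strictly larger, so F(L) < F(C).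

module Submission where

open import Defs
open import Data.Bool using (Bool; true; false; not; _∧_; _∨_; if_then_else_)
open import Data.Bool.Properties
  using (T-≡; ∧-zeroʳ; ∧-identityʳ; ∨-identityʳ; ¬-not; not-injective) renaming (_≟_ to _≟ᴮ_)
open import Data.Empty using (⊥; ⊥-elim)
open import Data.Fin using (Fin; toℕ; fromℕ<; inject≤) renaming (zero to fzero; suc to fsuc)
open import Data.Fin.Properties
  using (toℕ-fromℕ<; toℕ<n; toℕ-injective; toℕ-inject≤; inject≤-injective; injective⇒≤; +↔⊎; *↔×; 0↔⊥)
open import Data.List using (List; []; _∷_; _++_; upTo; applyUpTo; length; lookup)
open import Data.List.Properties using (length-applyUpTo; lookup-applyUpTo; length-upTo)
open import Data.List.Membership.Propositional using (_∈_)
open import Data.List.Membership.Propositional.Properties using (∈-++⁺ˡ)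
open import Data.List.Relation.Unary.Any using (here; there)
open import Data.List.Relation.Unary.Linked as Linked using (Linked; []; [-]; _∷_)
open import Data.List.Relation.Unary.Unique.Propositional.Properties using (upTo⁺)
open import Data.Nat
open import Data.Nat.Properties
open import Data.Nat.Tactic.RingSolver using (solve-∀)
open import Data.Product using (Σ; _×_; _,_; proj₁; proj₂)
open import Data.Product.Function.NonDependent.Propositional using (_×-↔_)
open import Data.Sum using (_⊎_; inj₁; inj₂)
open import Data.Sum.Function.Propositional using (_⊎-↔_)
open import Data.Vec as Vec using (Vec; []; _∷_; tabulate)
open import Data.Vec.Properties using (lookup∘tabulate)
open import Function using (_∘_; id; Equivalence)
open import Function.Bundles using (_↔_; Inverse; Injection)
open import Function.Properties.Inverse using (↔-trans; ↔-refl; ↔-sym; ↔⇒↣)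
open import Relation.Binary.Definitions using (tri<; tri≈; tri>)
open import Relation.Binary.PropositionalEquality
open import Relation.Binary.PropositionalEquality.Properties using (subst-injective)
open import Relation.Nullary using (yes; no)
open import Relation.Nullary.Decidable using (recompute)

true≢false : true ≢ false
true≢false ()

<⇒<ᵇ≡true : ∀ {m n} → m < n → (m <ᵇ n) ≡ true
<⇒<ᵇ≡true = Equivalence.to T-≡ ∘ <⇒<ᵇ

≤⇒<ᵇ≡false : ∀ {m n} → n ≤ m → (m <ᵇ n) ≡ false
≤⇒<ᵇ≡false {m}     {zero}  _       = refl
≤⇒<ᵇ≡false {suc m} {suc n} (s≤s p) = ≤⇒<ᵇ≡false p

<ᵇ≡true⇒< : ∀ m n → (m <ᵇ n) ≡ true → m < n
<ᵇ≡true⇒< m n e = <ᵇ⇒< m n (Equivalence.from T-≡ e)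

<ᵇ≡false⇒≥ : ∀ m n → (m <ᵇ n) ≡ false → n ≤ m
<ᵇ≡false⇒≥ m n e = ≮⇒≥ (λ m<n → true≢false (trans (sym (<⇒<ᵇ≡true m<n)) e))

≡ᵇ-refl : ∀ m → (m ≡ᵇ m) ≡ true
≡ᵇ-refl m = Equivalence.to T-≡ (≡⇒≡ᵇ m m refl)

≢⇒≡ᵇ≡false : ∀ {m n} → m ≢ n → (m ≡ᵇ n) ≡ false
≢⇒≡ᵇ≡false {zero}  {zero}  p = ⊥-elim (p refl)
≢⇒≡ᵇ≡false {zero}  {suc n} p = refl
≢⇒≡ᵇ≡false {suc m} {zero}  p = refl
≢⇒≡ᵇ≡false {suc m} {suc n} p = ≢⇒≡ᵇ≡false (p ∘ cong suc)

data LtView (m n : ℕ) : Set where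
  is-lt : m < n → (m <ᵇ n) ≡ true → LtView m n
  is-ge : n ≤ m → (m <ᵇ n) ≡ false → LtView m n

ltView : ∀ m n → LtView m n
ltView m n with m <ᵇ n in e
... | true  = is-lt (<ᵇ≡true⇒< m n e) e
... | false = is-ge (<ᵇ≡false⇒≥ m n e) e

if-true : ∀ {A : Set} {b : Bool} {x y : A} → b ≡ true → (if b then x else y) ≡ x
if-true refl = refl

if-false : ∀ {A : Set} {b : Bool} {x y : A} → b ≡ false → (if b then x else y) ≡ y
if-false refl = refl

recompute-≡ : {b c : Bool} → .(b ≡ c) → b ≡ c
recompute-≡ {b} {c} = recompute (b ≟ᴮ c)

∧≡true⇒ : ∀ {x y} → x ∧ y ≡ true → x ≡ true × y ≡ true
∧≡true⇒ {true} {true} _ = refl , refl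

memb-lookup : ∀ {n} (S : Vec Bool n) (i : Fin n) → memb S (toℕ i) ≡ Vec.lookup S i
memb-lookup (b ∷ S) fzero    = refl
memb-lookup (b ∷ S) (fsuc i) = memb-lookup S i

memb⇒< : ∀ {n} (S : Vec Bool n) v → memb S v ≡ true → v < n
memb⇒< (b ∷ S) zero    _ = s≤s z≤n
memb⇒< (b ∷ S) (suc v) e = s≤s (memb⇒< S v e)

memb-≥ : ∀ {n} (S : Vec Bool n) v → n ≤ v → memb S v ≡ false
memb-≥ []      v       _       = refl
memb-≥ (b ∷ S) (suc v) (s≤s p) = memb-≥ S v p

memb-tabulate : ∀ {n} (g : ℕ → Bool) v → v < n → memb (tabulate {n = n} (g ∘ toℕ)) v ≡ g v
memb-tabulate {suc n} g zero    _       = refl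
memb-tabulate {suc n} g (suc v) (s≤s p) = memb-tabulate (g ∘ suc) v p

memb-extensional : ∀ {n} (S S′ : Vec Bool n) → (∀ v → v < n → memb S v ≡ memb S′ v) → S ≡ S′
memb-extensional []      []        _ = refl
memb-extensional (b ∷ S) (b′ ∷ S′) h =
  cong₂ _∷_ (h 0 (s≤s z≤n)) (memb-extensional S S′ (λ v p → h (suc v) (s≤s p)))

ConnSub-≡ : ∀ {G} {x y : ConnSub G} →
            ConnSub.vset x ≡ ConnSub.vset y → ConnSub.eset x ≡ ConnSub.eset y → x ≡ y
ConnSub-≡ {x = connSub S T _ _ _} {connSub .S .T _ _ _} refl refl = refl

module _ {G : Graph} {T : EdgeSel G} where

  SelAdj-sym : ∀ {u w} → SelAdj G T u w → SelAdj G T w u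
  SelAdj-sym (j , e , inj₁ x) = j , e , inj₂ x
  SelAdj-sym (j , e , inj₂ x) = j , e , inj₁ x

  walk-++ : ∀ {u w v} → Walk G T u w → Walk G T w v → Walk G T u v
  walk-++ here       q = q
  walk-++ (step s p) q = step s (walk-++ p q)

  walk-reverse : ∀ {u v} → Walk G T u v → Walk G T v u
  walk-reverse here       = here
  walk-reverse (step s p) = walk-++ (walk-reverse p) (step (SelAdj-sym s) here)

tabGraph : ℕ → (ℕ → ℕ × ℕ) → ℕ → Graph
tabGraph n f m = graph n (applyUpTo f m)

Crosses : (ℕ → Bool) → ℕ × ℕ → Set
Crosses X (a , b) = (X a ≡ true × X b ≡ false) ⊎ (X a ≡ false × X b ≡ true)

module TabGraph (n : ℕ) (f : ℕ → ℕ × ℕ) (m : ℕ) where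

  G : Graph
  G = tabGraph n f m

  length-edges : length (applyUpTo f m) ≡ m
  length-edges = length-applyUpTo f m

  index : ∀ {t} → t < m → Fin (length (applyUpTo f m))
  index p = fromℕ< (subst (_ <_) (sym length-edges) p)

  toℕ-index : ∀ {t} (p : t < m) → toℕ (index p) ≡ t
  toℕ-index p = toℕ-fromℕ< _

  toℕ<m : (j : Fin (length (applyUpTo f m))) → toℕ j < m
  toℕ<m j = subst (toℕ j <_) length-edges (toℕ<n j)

  lookup-edges : (j : Fin (length (applyUpTo f m))) → lookup (applyUpTo f m) j ≡ f (toℕ j)
  lookup-edges j = lookup-applyUpTo f m j

  lookup-selected : (T : EdgeSel G) (j : Fin (length (applyUpTo f m))) →
                    Vec.lookup T j ≡ true → memb T (toℕ j) ≡ true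
  lookup-selected T j e = trans (memb-lookup T j) e

  selected⇒lookup : (T : EdgeSel G) {t : ℕ} (p : t < m) → memb T t ≡ true → Vec.lookup T (index p) ≡ true
  selected⇒lookup T p e = trans (sym (memb-lookup T (index p))) (trans (cong (memb T) (toℕ-index p)) e)

  selected⇒SelAdj : (T : EdgeSel G) (t : ℕ) {a b : ℕ} → t < m → memb T t ≡ true → f t ≡ (a , b) →
                    SelAdj G T a b
  selected⇒SelAdj T t p e q =
    index p , selected⇒lookup T p e , inj₁ (trans (lookup-edges (index p)) (trans (cong f (toℕ-index p)) q))

  walk-crosses : (T : EdgeSel G) {u v : ℕ} → Walk G T u v → (X : ℕ → Bool) → X u ≡ true → X v ≡ false →
                 Σ ℕ λ t → t < m × memb T t ≡ true × Crosses X (f t)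
  walk-crosses T here X xu xv = ⊥-elim (true≢false (trans (sym xu) xv))
  walk-crosses T (step {u} {w} (j , Tj , uw) rest) X xu xv with X w in xw
  ... | true  = walk-crosses T rest X xw xv
  ... | false = toℕ j , toℕ<m j , lookup-selected T j Tj , crosses uw
    where
      crosses : (lookup (applyUpTo f m) j ≡ (u , w)) ⊎ (lookup (applyUpTo f m) j ≡ (w , u)) → Crosses X (f (toℕ j))
      crosses (inj₁ q) = subst (Crosses X) (trans (sym q) (lookup-edges j)) (inj₁ (xu , xw))
      crosses (inj₂ q) = subst (Crosses X) (trans (sym q) (lookup-edges j)) (inj₂ (xw , xu))

  BothEnds : Vec Bool n → ℕ × ℕ → Set
  BothEnds S (a , b) = (memb S a ≡ true) × (memb S b ≡ true)

  EdgesInside : Vec Bool n → EdgeSel G → Set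
  EdgesInside S T = ∀ j → Vec.lookup T j ≡ true → BothEnds S (lookup (applyUpTo f m) j)

  Connected : Vec Bool n → EdgeSel G → Set
  Connected S T = ∀ u v → memb S u ≡ true → memb S v ≡ true → Walk G T u v

  selected⇒ends : (S : Vec Bool n) (T : EdgeSel G) → EdgesInside S T →
                  ∀ t → t < m → memb T t ≡ true → BothEnds S (f t)
  selected⇒ends S T inside t p e =
    subst (BothEnds S) (trans (lookup-edges (index p)) (cong f (toℕ-index p))) (inside (index p) (selected⇒lookup T p e))

  module PathWalks (n≤m : n ≤ m) (path : ∀ t → suc t < n → f (suc t) ≡ (t , suc t)) (T : EdgeSel G) where

    private
      walk+ : ∀ d a → a + d < n → (∀ t → a < t → t ≤ a + d → memb T t ≡ true) → Walk G T a (a + d)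
      walk+ zero a _ _ = subst (Walk G T a) (sym (+-identityʳ a)) here
      walk+ (suc d) a p h rewrite +-suc a d = step first (walk+ d (suc a) p (λ t q r → h t (<-trans (n<1+n a) q) r))
        where
          first : SelAdj G T a (suc a)
          first = selected⇒SelAdj T (suc a) (<-≤-trans (≤-<-trans (s≤s (m≤m+n a d)) p) n≤m)
                    (h (suc a) ≤-refl (s≤s (m≤m+n a d))) (path a (≤-<-trans (s≤s (m≤m+n a d)) p))

    walk-up : ∀ a b → a ≤ b → b < n → (∀ t → a < t → t ≤ b → memb T t ≡ true) → Walk G T a b
    walk-up a b a≤b b<n h = subst (Walk G T a) a+[b∸a]≡b
      (walk+ (b ∸ a) a (subst (_< n) (sym a+[b∸a]≡b) b<n) (λ t p q → h t p (subst (t ≤_) a+[b∸a]≡b q)))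
      where
        a+[b∸a]≡b : a + (b ∸ a) ≡ b
        a+[b∸a]≡b = m+[n∸m]≡n a≤b

    walk-down : ∀ a b → a ≤ b → b < n → (∀ t → a < t → t ≤ b → memb T t ≡ true) → Walk G T b a
    walk-down a b p q h = walk-reverse (walk-up a b p q h)

data FirstFalse (p : ℕ → Bool) (lo len : ℕ) : Set where
  allTrue    : (∀ i → lo ≤ i → i < lo + len → p i ≡ true) → FirstFalse p lo len
  firstFalse : (i : ℕ) → lo ≤ i → i < lo + len → p i ≡ false →
               (∀ i′ → lo ≤ i′ → i′ < i → p i′ ≡ true) → FirstFalse p lo len

data LastFalse (p : ℕ → Bool) (lo len : ℕ) : Set where
  allTrue   : (∀ i → lo ≤ i → i < lo + len → p i ≡ true) → LastFalse p lo len
  lastFalse : (i : ℕ) → lo ≤ i → i < lo + len → p i ≡ false →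
              (∀ i′ → i < i′ → i′ < lo + len → p i′ ≡ true) → LastFalse p lo len

private
  <+0-empty : ∀ {lo i : ℕ} → lo ≤ i → i < lo + 0 → ⊥
  <+0-empty {lo} {i} a b = <-irrefl refl (≤-<-trans a (subst (i <_) (+-identityʳ lo) b))

  extend-top : (p : ℕ → Bool) {lo len : ℕ} → (∀ i → lo ≤ i → i < lo + len → p i ≡ true) → p (lo + len) ≡ true →
               ∀ i → lo ≤ i → i < lo + suc len → p i ≡ true
  extend-top p {lo} {len} h e i a b with ltView i (lo + len)
  ... | is-lt q _ = h i a q
  ... | is-ge q _ = subst (λ z → p z ≡ true) (≤-antisym q (≤-pred (subst (i <_) (+-suc lo len) b))) e

  lo+len<lo+suc-len : ∀ lo len → lo + len < lo + suc len
  lo+len<lo+suc-len lo len = +-monoʳ-< lo (n<1+n len)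

searchFirstFalse : ∀ p lo len → FirstFalse p lo len
searchFirstFalse p lo zero = allTrue (λ i a b → ⊥-elim (<+0-empty a b))
searchFirstFalse p lo (suc len) with searchFirstFalse p lo len
... | firstFalse i a b c d = firstFalse i a (<-trans b (lo+len<lo+suc-len lo len)) c d
... | allTrue h with p (lo + len) in e
...   | false = firstFalse (lo + len) (m≤m+n lo len) (lo+len<lo+suc-len lo len) e h
...   | true  = allTrue (extend-top p h e)

searchLastFalse : ∀ p lo len → LastFalse p lo len
searchLastFalse p lo zero = allTrue (λ i a b → ⊥-elim (<+0-empty a b))
searchLastFalse p lo (suc len) with p (lo + len) in e
... | false = lastFalse (lo + len) (m≤m+n lo len) (lo+len<lo+suc-len lo len) e
                (λ i′ a b → ⊥-elim (<-irrefl refl (<-≤-trans a (≤-pred (subst (i′ <_) (+-suc lo len) b)))))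
... | true with searchLastFalse p lo len
...   | allTrue h = allTrue (extend-top p h e)
...   | lastFalse i a b c d = lastFalse i a (<-trans b (lo+len<lo+suc-len lo len)) c (extend-top-above d)
  where
    extend-top-above : (∀ i′ → i < i′ → i′ < lo + len → p i′ ≡ true) →
                       ∀ i′ → i < i′ → i′ < lo + suc len → p i′ ≡ true
    extend-top-above d i′ q r with ltView i′ (lo + len)
    ... | is-lt s _ = d i′ q s
    ... | is-ge s _ = subst (λ z → p z ≡ true) (≤-antisym s (≤-pred (subst (i′ <_) (+-suc lo len) r))) e

-- Relabelling L_{n,n-k} and C^n_{m₁,m₂} along their Hamiltonian paths

prev : ℕ → (ℕ → ℕ) → ℕ → ℕ
prev x g zero    = x
prev x g (suc t) = g t

applyUpTo-cong : ∀ {A : Set} {f g : ℕ → A} m → (∀ t → t < m → f t ≡ g t) → applyUpTo f m ≡ applyUpTo g m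
applyUpTo-cong zero    h = refl
applyUpTo-cong (suc m) h = cong₂ _∷_ (h 0 (s≤s z≤n)) (applyUpTo-cong m (λ t p → h (suc t) (s≤s p)))

pathEdges-applyUpTo : ∀ x g m → pathEdges (x ∷ applyUpTo g m) ≡ applyUpTo (λ t → (prev x g t , g t)) m
pathEdges-applyUpTo x g zero    = refl
pathEdges-applyUpTo x g (suc m) = cong ((x , g 0) ∷_) (trans (pathEdges-applyUpTo (g 0) (g ∘ suc) m)
  (applyUpTo-cong m (λ { zero _ → refl ; (suc t) _ → refl })))

applyUpTo-++ : ∀ {A : Set} (f g : ℕ → A) a b →
               applyUpTo f a ++ applyUpTo g b ≡ applyUpTo (λ t → if t <ᵇ a then f t else g (t ∸ a)) (a + b)
applyUpTo-++ f g zero    b = refl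
applyUpTo-++ f g (suc a) b = cong (f 0 ∷_) (applyUpTo-++ (f ∘ suc) g a b)

applyUpTo-∷ʳ : ∀ {A : Set} (f : ℕ → A) m y →
               applyUpTo f m ++ (y ∷ []) ≡ applyUpTo (λ t → if t <ᵇ m then f t else y) (suc m)
applyUpTo-∷ʳ f zero    y = refl
applyUpTo-∷ʳ f (suc m) y = cong (f 0 ∷_) (applyUpTo-∷ʳ (f ∘ suc) m y)

cycleSucc : ℕ → ℕ → ℕ
cycleSucc c t = if t <ᵇ c then suc t else 0

cycleEdge : ℕ → ℕ → ℕ × ℕ
cycleEdge c t = (prev 0 (cycleSucc c) t , cycleSucc c t)

tailEdge : ℕ → ℕ → ℕ × ℕ
tailEdge c s = (prev 0 (suc c +_) s , suc c + s)

LnkEdge : ℕ → ℕ → ℕ × ℕ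
LnkEdge c t = if t <ᵇ suc c then cycleEdge c t else tailEdge c (t ∸ suc c)

Lnk-edges : ∀ c k → edges (Lnk (suc c + k) k) ≡ applyUpTo (LnkEdge c) (suc c + k)
Lnk-edges c k rewrite m+n∸n≡m (suc c) k =
  trans (cong (λ es → pathEdges (0 ∷ es) ++ pathEdges (0 ∷ applyUpTo (suc c +_) k)) (applyUpTo-∷ʳ suc c 0))
  (trans (cong₂ _++_ (pathEdges-applyUpTo 0 (cycleSucc c) (suc c)) (pathEdges-applyUpTo 0 (suc c +_) k))
         (applyUpTo-++ (cycleEdge c) (tailEdge c) (suc c) k))

module CmmEdges (a k b : ℕ) where

  handleEnd : ℕ
  handleEnd = pathEnd (suc a) (suc k)

  secondCycleSucc : ℕ → ℕ
  secondCycleSucc t = if t <ᵇ b then a + suc k + t else handleEnd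

  secondCycle : ℕ → ℕ × ℕ
  secondCycle t = (prev handleEnd secondCycleSucc t , secondCycleSucc t)

  CmmEdge : ℕ → ℕ × ℕ
  CmmEdge t = if t <ᵇ suc a then cycleEdge a t
              else (if t ∸ suc a <ᵇ k then tailEdge a (t ∸ suc a) else secondCycle (t ∸ suc a ∸ k))

  Cmm-edges : edges (Cmm (suc a) (suc b) (suc k)) ≡ applyUpTo CmmEdge (suc a + (k + suc b))
  Cmm-edges =
    trans (cong₂ _++_ (trans (cong (λ es → pathEdges (0 ∷ es)) (applyUpTo-∷ʳ suc a 0))
                             (pathEdges-applyUpTo 0 (cycleSucc a) (suc a)))
                      (cong₂ _++_ (pathEdges-applyUpTo 0 (suc a +_) k)
                                  (trans (cong (λ es → pathEdges (handleEnd ∷ es)) (applyUpTo-∷ʳ (a + suc k +_) b handleEnd))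
                                         (pathEdges-applyUpTo handleEnd secondCycleSucc (suc b)))))
    (trans (cong (applyUpTo (cycleEdge a) (suc a) ++_) (applyUpTo-++ (tailEdge a) secondCycle k (suc b)))
           (applyUpTo-++ (cycleEdge a) _ (suc a) (k + suc b)))

-- Edge t + 1 is the path edge (t , t + 1) and edge 0 is the chord (c , 0), closing the cycle 0 … c.
-- dumbbellEdge a k b adds edge N = (N-1 , a+k) closing the second cycle; here m₁ = a + 1, m₂ = b + 1,
-- and the path joining the cycles has k edges, so the paper's k is k + 1.
lollipopEdge : ℕ → ℕ → ℕ × ℕ
lollipopEdge c zero    = (c , 0)
lollipopEdge c (suc t) = (t , suc t)

dumbbellEdge : ℕ → ℕ → ℕ → ℕ → ℕ × ℕ
dumbbellEdge a k b t = if t ≡ᵇ a + (k + suc b) then (a + (k + b) , a + k) else lollipopEdge a t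

-- Lnk and Cmm attach the path to vertex 0 of the cycle 0, 1, …, c; rotate c moves it to vertex c.
rotate : ℕ → ℕ → ℕ
rotate c zero    = c
rotate c (suc v) = if v <ᵇ c then v else suc v

unrotate : ℕ → ℕ → ℕ
unrotate c v = if v <ᵇ c then suc v else (if v ≡ᵇ c then 0 else v)

both : (ℕ → ℕ) → ℕ × ℕ → ℕ × ℕ
both g (a , b) = (g a , g b)

rotate-> : ∀ c v → c ≤ v → rotate c (suc v) ≡ suc v
rotate-> c v p = if-false (≤⇒<ᵇ≡false p)

unrotate-> : ∀ c v → c < v → unrotate c v ≡ v
unrotate-> c v p = trans (if-false (≤⇒<ᵇ≡false (<⇒≤ p))) (if-false (≢⇒≡ᵇ≡false (λ q → <-irrefl (sym q) p)))

unrotate-self : ∀ c → unrotate c c ≡ 0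
unrotate-self c = trans (if-false (≤⇒<ᵇ≡false (≤-refl {c}))) (if-true (≡ᵇ-refl c))

unrotate∘rotate : ∀ c v → unrotate c (rotate c v) ≡ v
unrotate∘rotate c zero = unrotate-self c
unrotate∘rotate c (suc v) with ltView v c
... | is-lt p e rewrite e = if-true (<⇒<ᵇ≡true p)
... | is-ge p e rewrite e = unrotate-> c (suc v) (s≤s p)

rotate∘unrotate : ∀ c v → rotate c (unrotate c v) ≡ v
rotate∘unrotate c v with ltView v c
... | is-lt p e rewrite e = if-true (<⇒<ᵇ≡true p)
... | is-ge p e rewrite e with v ≟ c
...   | yes refl rewrite ≡ᵇ-refl v = refl
...   | no v≢c rewrite ≢⇒≡ᵇ≡false v≢c with v
...     | zero   = ⊥-elim (v≢c (sym (n≤0⇒n≡0 p)))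
...     | suc v′ = rotate-> c v′ (≤-pred (≤∧≢⇒< p (v≢c ∘ sym)))

rotate-< : ∀ c n v → c < n → v < n → rotate c v < n
rotate-< c n zero    c<n _   = c<n
rotate-< c n (suc v) c<n v<n with ltView v c
... | is-lt p e rewrite e = <-trans (n<1+n v) v<n
... | is-ge p e rewrite e = v<n

unrotate-< : ∀ c n v → c < n → v < n → unrotate c v < n
unrotate-< c n v c<n v<n with ltView v c
... | is-lt p e rewrite e = ≤-<-trans p c<n
... | is-ge p e rewrite e with v ≡ᵇ c
...   | true  = ≤-<-trans z≤n v<n
...   | false = v<n

rotate-LnkEdge : ∀ c → 1 ≤ c → ∀ t → both (rotate c) (LnkEdge c t) ≡ lollipopEdge c t
rotate-LnkEdge c 1≤c t with ltView t (suc c)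
rotate-LnkEdge c 1≤c t | is-lt p e rewrite e = onCycle t p
  where
    onCycle : ∀ t → t < suc c → both (rotate c) (cycleEdge c t) ≡ lollipopEdge c t
    onCycle zero _ rewrite <⇒<ᵇ≡true 1≤c | <⇒<ᵇ≡true 1≤c = refl
    onCycle (suc t) (s≤s t≤c) rewrite <⇒<ᵇ≡true t≤c | <⇒<ᵇ≡true t≤c with ltView (suc t) c
    ... | is-lt q e′ rewrite e′ | e′ = refl
    ... | is-ge q e′ rewrite e′ = cong (t ,_) (≤-antisym q t≤c)
rotate-LnkEdge c 1≤c t | is-ge p e rewrite e | sym (m+[n∸m]≡n p) = onTail (t ∸ suc c)
  where
    onTail : ∀ s → both (rotate c) (tailEdge c (suc c + s ∸ suc c)) ≡ lollipopEdge c (suc c + s)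
    onTail s rewrite m+n∸m≡n (suc c) s with s
    ... | zero rewrite +-identityʳ c = cong (c ,_) (rotate-> c c ≤-refl)
    ... | suc s′ = cong₂ _,_ (trans (rotate-> c (c + s′) (m≤m+n c s′)) (sym (+-suc c s′)))
                             (rotate-> c (c + suc s′) (m≤m+n c (suc s′)))

unrotate-handleEnd : ∀ a k → unrotate a (a + k) ≡ pathEnd (suc a) (suc k)
unrotate-handleEnd a zero rewrite +-identityʳ a = unrotate-self a
unrotate-handleEnd a (suc k) = trans (unrotate-> a (a + suc k) (m<m+n a (s≤s z≤n))) (+-suc a k)

module _ (a k b : ℕ) (1≤a : 1 ≤ a) (1≤b : 1 ≤ b) where
  open CmmEdges a k b

  private
    N : ℕ
    N = a + (k + suc b)

    ≢N : ∀ t → t < N → (t ≡ᵇ N) ≡ false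
    ≢N t t<N = ≢⇒≡ᵇ≡false (λ e → <-irrefl e t<N)

    Agrees : ℕ → Set
    Agrees t = CmmEdge t ≡ both (unrotate a) (dumbbellEdge a k b t)

    shift : ∀ a k s → suc a + (k + s) ≡ a + (k + suc s)
    shift = solve-∀

    unrotate-above : ∀ s → unrotate a (suc (a + s)) ≡ suc (a + s)
    unrotate-above s = unrotate-> a (suc (a + s)) (s≤s (m≤m+n a s))

    onFirstCycle : ∀ t → t < suc a → Agrees t
    onFirstCycle t t≤a
      rewrite <⇒<ᵇ≡true t≤a | ≢N t (≤-<-trans (≤-pred t≤a) (m<m+n a (subst (0 <_) (sym (+-suc k b)) (s≤s z≤n))))
      = cycle t t≤a
      where
        cycle : ∀ t → t < suc a → cycleEdge a t ≡ both (unrotate a) (lollipopEdge a t)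
        cycle zero _ rewrite <⇒<ᵇ≡true 1≤a = cong₂ _,_ (sym (unrotate-self a)) refl
        cycle (suc t) (s≤s t<a) rewrite <⇒<ᵇ≡true t<a with ltView (suc t) a
        ... | is-lt _ e rewrite e = refl
        ... | is-ge q e rewrite e =
          cong (suc t ,_) (sym (if-true (subst (λ z → (suc t ≡ᵇ z) ≡ true) (≤-antisym t<a q) (≡ᵇ-refl (suc t)))))

    onHandle : ∀ s → s < k → Agrees (suc a + s)
    onHandle s s<k rewrite ≤⇒<ᵇ≡false {suc a + s} {suc a} (m≤m+n (suc a) s) | m+n∸m≡n (suc a) s | <⇒<ᵇ≡true s<k
      | ≢N (suc a + s) (subst (_< N) (+-suc a s) (+-monoʳ-< a (≤-<-trans s<k (m<m+n k (s≤s z≤n))))) = handle s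
      where
        handle : ∀ s → tailEdge a s ≡ both (unrotate a) (lollipopEdge a (suc (a + s)))
        handle zero rewrite +-identityʳ a = cong₂ _,_ (sym (unrotate-self a)) (sym (unrotate-> a (suc a) ≤-refl))
        handle (suc s) = cong₂ _,_ (sym (trans (unrotate-> a _ (m<m+n a (s≤s z≤n))) (+-suc a s))) (sym (unrotate-above (suc s)))

    secondCycleStart : ∀ a k → a + suc k + 0 ≡ suc (a + (k + 0))
    secondCycleStart = solve-∀

    secondCycleVertex : ∀ a k s → a + suc k + s ≡ a + (k + suc s)
    secondCycleVertex = solve-∀

    secondCycleNext : ∀ a k s → a + suc k + suc s ≡ suc (a + (k + suc s))
    secondCycleNext = solve-∀

    onSecondCycle : ∀ s → s < b → Agrees (suc a + (k + s))
    onSecondCycle s s<b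
      rewrite ≤⇒<ᵇ≡false {suc a + (k + s)} {suc a} (m≤m+n (suc a) (k + s)) | m+n∸m≡n (suc a) (k + s)
            | ≤⇒<ᵇ≡false {k + s} {k} (m≤m+n k s) | m+n∸m≡n k s
            | ≢N _ (subst (_< N) (sym (shift a k s)) (+-monoʳ-< a (+-monoʳ-< k (s≤s s<b)))) = cycle s s<b
      where
        cycle : ∀ s → s < b → secondCycle s ≡ both (unrotate a) (lollipopEdge a (suc (a + (k + s))))
        cycle zero s<b rewrite <⇒<ᵇ≡true s<b =
          cong₂ _,_ (sym (trans (cong (λ z → unrotate a (a + z)) (+-identityʳ k)) (unrotate-handleEnd a k)))
                    (trans (secondCycleStart a k) (sym (unrotate-above (k + 0))))
        cycle (suc s) s<b rewrite <⇒<ᵇ≡true s<b | <⇒<ᵇ≡true (<-trans (n<1+n s) s<b) =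
          cong₂ _,_ (trans (secondCycleVertex a k s) (sym (unrotate-> a _ (m<m+n a (subst (0 <_) (sym (+-suc k s)) (s≤s z≤n))))))
                    (trans (secondCycleNext a k s) (sym (unrotate-above (k + suc s))))

    onSecondChord : Agrees (suc a + (k + b))
    onSecondChord
      rewrite ≤⇒<ᵇ≡false {suc a + (k + b)} {suc a} (m≤m+n (suc a) (k + b)) | m+n∸m≡n (suc a) (k + b)
            | ≤⇒<ᵇ≡false {k + b} {k} (m≤m+n k b) | m+n∸m≡n k b | shift a k b | ≡ᵇ-refl N
      = closing (b ∸ 1) (m+[n∸m]≡n 1≤b)
      where
        closing : ∀ b′ → suc b′ ≡ b → secondCycle b ≡ (unrotate a (a + (k + b)) , unrotate a (a + k))
        closing b′ refl rewrite <⇒<ᵇ≡true (n<1+n b′) | ≤⇒<ᵇ≡false (≤-refl {b′}) =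
          cong₂ _,_ (trans (secondCycleVertex a k b′) (sym (unrotate-> a _ (m<m+n a (subst (0 <_) (sym (+-suc k b′)) (s≤s z≤n))))))
                    (sym (unrotate-handleEnd a k))

  unrotate-dumbbellEdge : ∀ t → t ≤ N → CmmEdge t ≡ both (unrotate a) (dumbbellEdge a k b t)
  unrotate-dumbbellEdge t t≤N with ltView t (suc a)
  ... | is-lt t≤a _ = onFirstCycle t t≤a
  ... | is-ge a<t _ with ltView (t ∸ suc a) k
  ...   | is-lt s<k _ = subst Agrees (m+[n∸m]≡n a<t) (onHandle (t ∸ suc a) s<k)
  ...   | is-ge k≤s _ with ltView (t ∸ suc a ∸ k) b
  ...     | is-lt s<b _ = subst Agrees t≡ (onSecondCycle (t ∸ suc a ∸ k) s<b)
    where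
      t≡ : suc a + (k + (t ∸ suc a ∸ k)) ≡ t
      t≡ = trans (cong (suc a +_) (m+[n∸m]≡n k≤s)) (m+[n∸m]≡n a<t)
  ...     | is-ge b≤s _ = subst Agrees t≡ onSecondChord
    where
      s = t ∸ suc a ∸ k
      t≡s : suc a + (k + s) ≡ t
      t≡s = trans (cong (suc a +_) (m+[n∸m]≡n k≤s)) (m+[n∸m]≡n a<t)
      s≤b : s ≤ b
      s≤b = +-cancelˡ-≤ k s b (+-cancelˡ-≤ (suc a) (k + s) (k + b)
              (subst₂ _≤_ (sym t≡s) (sym (shift a k b)) t≤N))
      t≡ : suc a + (k + b) ≡ t
      t≡ = trans (cong (λ z → suc a + (k + z)) (≤-antisym b≤s s≤b)) t≡s

module Transport (n m m′ : ℕ) (f f′ : ℕ → ℕ × ℕ) (m≤m′ : m ≤ m′)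
                 (σ τ : ℕ → ℕ) (σ-< : ∀ v → v < n → σ v < n)
                 (τ∘σ : ∀ v → v < n → τ (σ v) ≡ v) (σ∘τ : ∀ v → v < n → σ (τ v) ≡ v) where

  module Src = TabGraph n f m
  module Dst = TabGraph n f′ m′

  Preserves : EdgeSel Src.G → Set
  Preserves T = ∀ t → t < m → memb T t ≡ true → f′ t ≡ both σ (f t)

  mapV : Vec Bool n → Vec Bool n
  mapV S = tabulate (memb S ∘ τ ∘ toℕ)

  mapE : EdgeSel Src.G → EdgeSel Dst.G
  mapE T = tabulate (memb T ∘ toℕ)

  memb-mapV : ∀ S v → v < n → memb (mapV S) (σ v) ≡ memb S v
  memb-mapV S v v<n = trans (memb-tabulate (memb S ∘ τ) (σ v) (σ-< v v<n)) (cong (memb S) (τ∘σ v v<n))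

  memb-mapE : ∀ T t → memb (mapE T) t ≡ memb T t
  memb-mapE T t with ltView t (length (applyUpTo f′ m′))
  ... | is-lt p _ = memb-tabulate (memb T) t p
  ... | is-ge p _ = trans (memb-≥ (mapE T) t p)
                      (sym (memb-≥ T t (subst (_≤ t) (sym Src.length-edges)
                        (≤-trans m≤m′ (subst (_≤ t) Dst.length-edges p)))))

  walk-map : (T : EdgeSel Src.G) → Preserves T → ∀ {a b} → Walk Src.G T a b → Walk Dst.G (mapE T) (σ a) (σ b)
  walk-map T pres here = here
  walk-map T pres (step {a} {w} (j , Tj , aw) rest) = step (edge aw) (walk-map T pres rest)
    where
      t = toℕ j
      Tt : memb T t ≡ true
      Tt = Src.lookup-selected T j Tj
      f′t : f′ t ≡ both σ (lookup (applyUpTo f m) j)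
      f′t = trans (pres t (Src.toℕ<m j) Tt) (cong (both σ) (sym (Src.lookup-edges j)))
      image : ∀ {x y} → lookup (applyUpTo f m) j ≡ (x , y) → SelAdj Dst.G (mapE T) (σ x) (σ y)
      image q = Dst.selected⇒SelAdj (mapE T) t (≤-trans (Src.toℕ<m j) m≤m′) (trans (memb-mapE T t) Tt)
                  (trans f′t (cong (both σ) q))
      edge : (lookup (applyUpTo f m) j ≡ (a , w)) ⊎ (lookup (applyUpTo f m) j ≡ (w , a)) → SelAdj Dst.G (mapE T) (σ a) (σ w)
      edge (inj₁ q) = image q
      edge (inj₂ q) = SelAdj-sym {G = Dst.G} {T = mapE T} (image q)

  transport : (x : ConnSub Src.G) → Preserves (ConnSub.eset x) → ConnSub Dst.G
  transport (connSub S T nonempty inside conn) pres = connSub (mapV S) (mapE T) (nonempty′ nonempty) (inside′ inside) (conn′ conn)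
    where
      nonempty′ : (Σ (Fin n) λ i → Vec.lookup S i ≡ true) → Σ (Fin n) λ i → Vec.lookup (mapV S) i ≡ true
      nonempty′ (i , Si) = let i<n = toℕ<n i in
        fromℕ< (σ-< (toℕ i) i<n) ,
        trans (sym (memb-lookup (mapV S) _)) (trans (cong (memb (mapV S)) (toℕ-fromℕ< _))
          (trans (memb-mapV S (toℕ i) i<n) (trans (memb-lookup S i) Si)))
      inside′ : Src.EdgesInside S T → Dst.EdgesInside (mapV S) (mapE T)
      inside′ inside j e = subst (Dst.BothEnds (mapV S)) (sym (trans (Dst.lookup-edges j) (pres t t<m Tt))) (image ends)
        where
          t = toℕ j
          Tt : memb T t ≡ true
          Tt = trans (sym (memb-mapE T t)) (Dst.lookup-selected (mapE T) j e)
          t<m : t < m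
          t<m = subst (t <_) Src.length-edges (memb⇒< T t Tt)
          ends = Src.selected⇒ends S T inside t t<m Tt
          image : ∀ {x y} → Src.BothEnds S (x , y) → Dst.BothEnds (mapV S) (both σ (x , y))
          image (Sx , Sy) = trans (memb-mapV S _ (memb⇒< S _ Sx)) Sx , trans (memb-mapV S _ (memb⇒< S _ Sy)) Sy
      conn′ : Src.Connected S T → Dst.Connected (mapV S) (mapE T)
      conn′ conn u v Su Sv = subst₂ (Walk Dst.G (mapE T)) (σ∘τ u u<n) (σ∘τ v v<n)
                          (walk-map T pres (conn (τ u) (τ v) (preimage u u<n Su) (preimage v v<n Sv)))
        where
          u<n = memb⇒< (mapV S) u Su
          v<n = memb⇒< (mapV S) v Sv
          preimage : ∀ x → x < n → memb (mapV S) x ≡ true → memb S (τ x) ≡ true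
          preimage x x<n Sx = trans (sym (memb-tabulate (memb S ∘ τ) x x<n)) Sx

  memb-transport : ∀ x pres t → memb (ConnSub.eset (transport x pres)) t ≡ memb (ConnSub.eset x) t
  memb-transport (connSub S T _ _ _) pres t = memb-mapE T t

  transport-injective : ∀ x y px py → transport x px ≡ transport y py → x ≡ y
  transport-injective (connSub S T _ _ _) (connSub S′ T′ _ _ _) _ _ e = ConnSub-≡
    (memb-extensional S S′ (λ v v<n → trans (sym (memb-mapV S v v<n))
      (trans (cong (λ z → memb z (σ v)) (cong ConnSub.vset e)) (memb-mapV S′ v v<n))))
    (memb-extensional T T′ (λ t _ → trans (sym (memb-mapE T t))
      (trans (cong (λ z → memb z t) (cong ConnSub.eset e)) (memb-mapE T′ t))))

-- Connected subgraphs of the lollipop through its chord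

-- The gap (u , w) removes the edges u+1, …, w (edge t joins t-1 and t) and the vertices strictly
-- between u and w; (0 , 0) removes nothing.
gapVertex : ℕ → ℕ → ℕ → Bool
gapVertex u w v = (u <ᵇ v) ∧ (v <ᵇ w)

gapEdge : ℕ → ℕ → ℕ → Bool
gapEdge u w t = (u <ᵇ t) ∧ (t <ᵇ suc w)

gapVertex-inside : ∀ {u w v} → u < v → v < w → gapVertex u w v ≡ true
gapVertex-inside p q rewrite <⇒<ᵇ≡true p | <⇒<ᵇ≡true q = refl

gapVertex-below : ∀ {u w v} → v ≤ u → gapVertex u w v ≡ false
gapVertex-below p rewrite ≤⇒<ᵇ≡false p = refl

gapVertex-above : ∀ {u w v} → w ≤ v → gapVertex u w v ≡ false
gapVertex-above {u} {w} {v} p rewrite ≤⇒<ᵇ≡false p = ∧-zeroʳ (u <ᵇ v)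

gapVertex-sound : ∀ u w v → gapVertex u w v ≡ true → u < v × v < w
gapVertex-sound u w v e with ltView u v | ltView v w
... | is-lt p _ | is-lt q _ = p , q
... | is-lt _ a | is-ge _ b rewrite a | b = ⊥-elim (true≢false (sym e))
... | is-ge _ a | _         rewrite a     = ⊥-elim (true≢false (sym e))

gapEdge-inside : ∀ {u w t} → u < t → t ≤ w → gapEdge u w t ≡ true
gapEdge-inside p q rewrite <⇒<ᵇ≡true p | <⇒<ᵇ≡true (s≤s q) = refl

gapEdge-below : ∀ {u w t} → t ≤ u → gapEdge u w t ≡ false
gapEdge-below p rewrite ≤⇒<ᵇ≡false p = refl

gapEdge-above : ∀ {u w t} → w < t → gapEdge u w t ≡ false
gapEdge-above {u} {w} {t} p rewrite ≤⇒<ᵇ≡false p = ∧-zeroʳ (u <ᵇ t)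

outside⇒¬gapVertex : ∀ {u w v} → v ≤ u ⊎ w ≤ v → not (gapVertex u w v) ≡ true
outside⇒¬gapVertex {u} {w} {v} (inj₁ p) = cong not (gapVertex-below {u} {w} {v} p)
outside⇒¬gapVertex {u} {w} {v} (inj₂ p) = cong not (gapVertex-above {u} {w} {v} p)

¬gapVertex⇒outside : ∀ u w v → not (gapVertex u w v) ≡ true → v ≤ u ⊎ w ≤ v
¬gapVertex⇒outside u w v e with ltView u v | ltView v w
... | is-ge p _ | _         = inj₁ p
... | is-lt _ _ | is-ge q _ = inj₂ q
... | is-lt p _ | is-lt q _ rewrite gapVertex-inside {u} {w} {v} p q = ⊥-elim (true≢false (sym e))

outside⇒¬gapEdge : ∀ {u w t} → t ≤ u ⊎ w < t → not (gapEdge u w t) ≡ true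
outside⇒¬gapEdge {u} {w} {t} (inj₁ p) = cong not (gapEdge-below {u} {w} {t} p)
outside⇒¬gapEdge {u} {w} {t} (inj₂ p) = cong not (gapEdge-above {u} {w} {t} p)

¬gapEdge⇒outside : ∀ u w t → not (gapEdge u w t) ≡ true → t ≤ u ⊎ w < t
¬gapEdge⇒outside u w t e with ltView u t | ltView w t
... | is-ge p _ | _         = inj₁ p
... | is-lt _ _ | is-lt q _ = inj₂ q
... | is-lt p _ | is-ge q _ rewrite gapEdge-inside {u} {w} {t} p q = ⊥-elim (true≢false (sym e))

gapVertex-empty : ∀ v → gapVertex 0 0 v ≡ false
gapVertex-empty zero    = refl
gapVertex-empty (suc v) = refl

gapEdge-empty : ∀ t → gapEdge 0 0 t ≡ false
gapEdge-empty zero    = refl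
gapEdge-empty (suc t) = refl

GapWithin : ℕ → ℕ → ℕ → ℕ → Set
GapWithin L R u w = (u ≡ L × w ≡ L) ⊎ (L ≤ u × u < w × w ≤ R)

module Lollipop (c n : ℕ) (c+1<n : suc c < n) where
  open TabGraph n (lollipopEdge c) n

  c<n : c < n
  c<n = <-trans (n<1+n c) c+1<n

  n∸1+1≡n : suc (n ∸ 1) ≡ n
  n∸1+1≡n = m+[n∸m]≡n {1} {n} (≤-trans (s≤s z≤n) c+1<n)

  record CycleShape (S : Vec Bool n) (T : EdgeSel G) : Set where
    field
      u w      : ℕ
      bounds   : GapWithin 0 c u w
      vertices : ∀ v → v ≤ c → memb S v ≡ not (gapVertex u w v)
      edges    : ∀ t → 1 ≤ t → t ≤ c → memb T t ≡ not (gapEdge u w t)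

  record TailShape (S : Vec Bool n) (T : EdgeSel G) : Set where
    field
      j        : ℕ
      c≤j      : c ≤ j
      j<n      : j < n
      vertices : ∀ v → c < v → v < n → memb S v ≡ (v <ᵇ suc j)
      edges    : ∀ t → c < t → t < n → memb T t ≡ (t <ᵇ suc j)

  module _ (S : Vec Bool n) (T : EdgeSel G) (inside : EdgesInside S T) (conn : Connected S T)
           (chord : memb T 0 ≡ true) where

    0∈S : memb S 0 ≡ true
    0∈S = proj₂ (selected⇒ends S T inside 0 (≤-trans (s≤s z≤n) c+1<n) chord)

    c∈S : memb S c ≡ true
    c∈S = proj₁ (selected⇒ends S T inside 0 (≤-trans (s≤s z≤n) c+1<n) chord)

    head∈S : ∀ t → suc t < n → memb T (suc t) ≡ true → memb S (suc t) ≡ true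
    head∈S t p e = proj₂ (selected⇒ends S T inside (suc t) p e)

    tail∈S : ∀ t → suc t < n → memb T (suc t) ≡ true → memb S t ≡ true
    tail∈S t p e = proj₁ (selected⇒ends S T inside (suc t) p e)

    head∈S′ : ∀ t → 1 ≤ t → t < n → memb T t ≡ true → memb S t ≡ true
    head∈S′ (suc t) _ = head∈S t

    tail∈S′ : ∀ t → 1 ≤ t → t < n → memb T t ≡ true → memb S (pred t) ≡ true
    tail∈S′ (suc t) _ = tail∈S t

    ≤c⇒<n : ∀ {v} → v ≤ c → v < n
    ≤c⇒<n v≤c = ≤-<-trans v≤c c<n

    -- A walk from v to 0 has to leave the gap (resp. the part of the tail beyond j), and the only
    -- edges doing so are the missing ones u+1 and w (resp. j+1).
    gap∉S : ∀ u w → memb T (suc u) ≡ false → memb T w ≡ false → w ≤ c →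
            ∀ v → u < v → v < w → memb S v ≡ true → ⊥
    gap∉S u w Tu Tw w≤c v u<v v<w Sv
      with walk-crosses T (conn v 0 Sv 0∈S) (gapVertex u w) (gapVertex-inside u<v v<w) (gapVertex-below {u} {w} z≤n)
    ... | zero , _ , _ , inj₁ (a , _) = true≢false (trans (sym a) (gapVertex-above {u} w≤c))
    ... | zero , _ , _ , inj₂ (_ , b) = true≢false (trans (sym b) (gapVertex-below {u} {w} z≤n))
    ... | suc t , _ , Tt , inj₁ (a , b) with gapVertex-sound u w t a
    ...   | u<t , t<w with ltView (suc t) w
    ...     | is-lt r _ = true≢false (trans (sym (gapVertex-inside (<-trans u<t (n<1+n t)) r)) b)
    ...     | is-ge r _ = true≢false (trans (sym Tt) (subst (λ z → memb T z ≡ false) (≤-antisym r t<w) Tw))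
    gap∉S u w Tu Tw w≤c v u<v v<w Sv | suc t , _ , Tt , inj₂ (a , b) with gapVertex-sound u w (suc t) b
    ...   | u<t+1 , t+1<w with ltView u t
    ...     | is-lt r _ = true≢false (trans (sym (gapVertex-inside r (<-trans (n<1+n t) t+1<w))) a)
    ...     | is-ge r _ = true≢false (trans (sym Tt) (subst (λ z → memb T (suc z) ≡ false) (≤-antisym (≤-pred u<t+1) r) Tu))

    beyondTail∉S : ∀ j → c ≤ j → memb T (suc j) ≡ false → ∀ v → j < v → memb S v ≡ true → ⊥
    beyondTail∉S j c≤j Tj v j<v Sv with walk-crosses T (conn v 0 Sv 0∈S) (j <ᵇ_) (<⇒<ᵇ≡true j<v) refl
    ... | zero , _ , _ , inj₁ (a , _) = true≢false (trans (sym a) (≤⇒<ᵇ≡false c≤j))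
    ... | zero , _ , _ , inj₂ (_ , b) = true≢false (sym b)
    ... | suc t , _ , _ , inj₁ (a , b) = true≢false (trans (sym (<⇒<ᵇ≡true (<-trans (<ᵇ≡true⇒< j t a) (n<1+n t)))) b)
    ... | suc t , _ , Tt , inj₂ (a , b) = true≢false (trans (sym Tt)
          (subst (λ z → memb T (suc z) ≡ false) (≤-antisym (≤-pred (<ᵇ≡true⇒< j (suc t) b)) (<ᵇ≡false⇒≥ j t a)) Tj))

    module _ (u w : ℕ) (u<w : u < w) (Tu : memb T (suc u) ≡ false) (Tw : memb T w ≡ false) (w≤c : w ≤ c)
             (before : ∀ i → 1 ≤ i → i < suc u → memb T i ≡ true)
             (after : ∀ i → w < i → i < 1 + c → memb T i ≡ true) where

      gapEdges : ∀ t → 1 ≤ t → t ≤ c → memb T t ≡ not (gapEdge u w t)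
      gapEdges t 1≤t t≤c with ltView u t
      ... | is-ge t≤u _ rewrite gapEdge-below {u} {w} {t} t≤u = before t 1≤t (s≤s t≤u)
      ... | is-lt u<t _ with ltView w t
      ...   | is-lt w<t _ rewrite gapEdge-above {u} {w} {t} w<t = after t w<t (s≤s t≤c)
      ...   | is-ge t≤w _ rewrite gapEdge-inside {u} {w} {t} u<t t≤w with ltView t w
      ...     | is-lt t<w _ = ¬-not (λ Tt → gap∉S u w Tu Tw w≤c t u<t t<w (head∈S′ t 1≤t (≤c⇒<n t≤c) Tt))
      ...     | is-ge w≤t _ = subst (λ z → memb T z ≡ false) (≤-antisym w≤t t≤w) Tw

      gapVertices : ∀ v → v ≤ c → memb S v ≡ not (gapVertex u w v)
      gapVertices v v≤c with ltView u v
      ... | is-ge v≤u _ rewrite gapVertex-below {u} {w} {v} v≤u = below v v≤u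
        where
          below : ∀ v → v ≤ u → memb S v ≡ true
          below zero    _   = 0∈S
          below (suc v) v<u = head∈S v (≤c⇒<n (≤-trans v<u (<⇒≤ (<-≤-trans u<w w≤c))))
                                (before (suc v) (s≤s z≤n) (s≤s v<u))
      ... | is-lt u<v _ with ltView v w
      ...   | is-lt v<w _ rewrite gapVertex-inside {u} {w} {v} u<v v<w = ¬-not (gap∉S u w Tu Tw w≤c v u<v v<w)
      ...   | is-ge w≤v _ rewrite gapVertex-above {u} {w} {v} w≤v with ltView v c
      ...     | is-lt v<c _ = tail∈S v (≤-<-trans v<c c<n) (after (suc v) (s≤s w≤v) (s≤s v<c))
      ...     | is-ge c≤v _ = subst (λ z → memb S z ≡ true) (≤-antisym c≤v v≤c) c∈S

    module _ (fullCycle : ∀ i → 1 ≤ i → i < 1 + c → memb T i ≡ true) where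

      noGapEdges : ∀ t → 1 ≤ t → t ≤ c → memb T t ≡ not (gapEdge 0 0 t)
      noGapEdges t 1≤t t≤c rewrite gapEdge-above {0} {0} {t} 1≤t = fullCycle t 1≤t (s≤s t≤c)

      noGapVertices : ∀ v → v ≤ c → memb S v ≡ not (gapVertex 0 0 v)
      noGapVertices zero    _   = 0∈S
      noGapVertices (suc v) v<c rewrite gapVertex-above {0} {0} {suc v} z≤n =
        head∈S v (≤c⇒<n v<c) (fullCycle (suc v) (s≤s z≤n) (s≤s v<c))

    module _ (j : ℕ) (c≤j : c ≤ j) (Tj : memb T (suc j) ≡ false)
             (upto : ∀ i → suc c ≤ i → i < suc j → memb T i ≡ true) where

      tailEdges : ∀ t → c < t → t < n → memb T t ≡ (t <ᵇ suc j)
      tailEdges t c<t t<n with ltView t (suc j)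
      ... | is-lt t≤j e rewrite e = upto t c<t t≤j
      ... | is-ge j<t e rewrite e with ltView (suc j) t
      ...   | is-ge t≤j+1 _ = subst (λ z → memb T z ≡ false) (≤-antisym j<t t≤j+1) Tj
      ...   | is-lt j+1<t _ = ¬-not (λ Tt → beyondTail∉S j c≤j Tj (pred t) (pred-mono-≤ j+1<t)
                                      (tail∈S′ t (≤-trans (s≤s z≤n) c<t) t<n Tt))

      tailVertices : ∀ v → c < v → v < n → memb S v ≡ (v <ᵇ suc j)
      tailVertices v c<v v<n with ltView v (suc j)
      ... | is-lt v≤j e rewrite e = head∈S′ v (≤-trans (s≤s z≤n) c<v) v<n (upto v c<v v≤j)
      ... | is-ge j<v e rewrite e = ¬-not (beyondTail∉S j c≤j Tj v j<v)

    module _ (fullTail : ∀ i → suc c ≤ i → i < n → memb T i ≡ true) where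

      fullTailEdges : ∀ t → c < t → t < n → memb T t ≡ (t <ᵇ suc (n ∸ 1))
      fullTailEdges t c<t t<n rewrite n∸1+1≡n | <⇒<ᵇ≡true t<n = fullTail t c<t t<n

      fullTailVertices : ∀ v → c < v → v < n → memb S v ≡ (v <ᵇ suc (n ∸ 1))
      fullTailVertices v c<v v<n rewrite n∸1+1≡n | <⇒<ᵇ≡true v<n =
        head∈S′ v (≤-trans (s≤s z≤n) c<v) v<n (fullTail v c<v v<n)

  cycleShape : (S : Vec Bool n) (T : EdgeSel G) → .(EdgesInside S T) → .(Connected S T) →
               memb T 0 ≡ true → CycleShape S T
  cycleShape S T inside conn chord with searchFirstFalse (memb T) 1 c
  ... | allTrue full = record
    { u = 0 ; w = 0 ; bounds = inj₁ (refl , refl)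
    ; vertices = λ v v≤c → recompute-≡ (noGapVertices S T inside conn chord full v v≤c)
    ; edges = λ t 1≤t t≤c → recompute-≡ (noGapEdges S T inside conn chord full t 1≤t t≤c) }
  ... | firstFalse (suc u) _ u<c Tu before with searchLastFalse (memb T) 1 c
  ...   | allTrue full = ⊥-elim (true≢false (trans (sym (full (suc u) (s≤s z≤n) u<c)) Tu))
  ...   | lastFalse w 1≤w w<c+1 Tw after = record
    { u = u ; w = w ; bounds = inj₂ (z≤n , u<w , ≤-pred w<c+1)
    ; vertices = λ v v≤c → recompute-≡ (gapVertices S T inside conn chord u w u<w Tu Tw (≤-pred w<c+1) before after v v≤c)
    ; edges = λ t 1≤t t≤c →
        recompute-≡ (gapEdges S T inside conn chord u w u<w Tu Tw (≤-pred w<c+1) before after t 1≤t t≤c) }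
    where
      u<w : u < w
      u<w with ltView w (suc u)
      ... | is-lt w≤u _ = ⊥-elim (true≢false (trans (sym (after (suc u) w≤u u<c)) Tu))
      ... | is-ge u<w _ = u<w

  tailShape : (S : Vec Bool n) (T : EdgeSel G) → .(EdgesInside S T) → .(Connected S T) →
              memb T 0 ≡ true → TailShape S T
  tailShape S T inside conn chord with searchFirstFalse (memb T) (suc c) (n ∸ suc c)
  ... | allTrue full = record
    { j = n ∸ 1 ; c≤j = ≤-pred (subst (suc c ≤_) (sym n∸1+1≡n) (<⇒≤ c+1<n))
    ; j<n = subst (n ∸ 1 <_) n∸1+1≡n ≤-refl
    ; vertices = λ v c<v v<n → recompute-≡ (fullTailVertices S T inside conn chord full′ v c<v v<n)
    ; edges = λ t c<t t<n → recompute-≡ (fullTailEdges S T inside conn chord full′ t c<t t<n) }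
    where
      full′ : ∀ i → suc c ≤ i → i < n → memb T i ≡ true
      full′ i c<i i<n = full i c<i (subst (i <_) (sym (m+[n∸m]≡n (<⇒≤ c+1<n))) i<n)
  ... | firstFalse (suc j) c<j+1 j+1<n Tj upto = record
    { j = j ; c≤j = ≤-pred c<j+1 ; j<n = <-trans (n<1+n j) j+1<n′
    ; vertices = λ v c<v v<n → recompute-≡ (tailVertices S T inside conn chord j (≤-pred c<j+1) Tj upto v c<v v<n)
    ; edges = λ t c<t t<n → recompute-≡ (tailEdges S T inside conn chord j (≤-pred c<j+1) Tj upto t c<t t<n) }
    where
      j+1<n′ : suc j < n
      j+1<n′ = subst (suc j <_) (m+[n∸m]≡n (<⇒≤ c+1<n)) j+1<n

  chordSubVertex : ℕ → ℕ → ℕ → ℕ → Bool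
  chordSubVertex u w j v = not (gapVertex u w v) ∧ (v <ᵇ suc j)

  chordSubEdge : ℕ → ℕ → ℕ → ℕ → Bool
  chordSubEdge u w j t = (t ≡ᵇ 0) ∨ (not (gapEdge u w t) ∧ (t <ᵇ suc j))

  record ChordShape (x : ConnSub G) : Set where
    field
      u w j  : ℕ
      bounds : GapWithin 0 c u w
      c≤j    : c ≤ j
      j<n    : j < n
      vset≡  : ConnSub.vset x ≡ tabulate (chordSubVertex u w j ∘ toℕ)
      eset≡  : ConnSub.eset x ≡ tabulate (chordSubEdge u w j ∘ toℕ)

  private
    w≤c : ∀ {u w} → GapWithin 0 c u w → w ≤ c
    w≤c (inj₁ (_ , refl)) = z≤n
    w≤c (inj₂ (_ , _ , w≤c)) = w≤c

    glueVertices : ∀ (S : Vec Bool n) u w j → w ≤ c → c ≤ j →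
                   (∀ v → v ≤ c → memb S v ≡ not (gapVertex u w v)) →
                   (∀ v → c < v → v < n → memb S v ≡ (v <ᵇ suc j)) →
                   ∀ v → v < n → memb S v ≡ chordSubVertex u w j v
    glueVertices S u w j w≤c c≤j onCycle onTail v v<n with ltView c v
    ... | is-ge v≤c _ = trans (onCycle v v≤c)
                          (sym (trans (cong (not (gapVertex u w v) ∧_) (<⇒<ᵇ≡true (s≤s (≤-trans v≤c c≤j)))) (∧-identityʳ _)))
    ... | is-lt c<v _ rewrite gapVertex-above {u} {w} {v} (≤-trans w≤c (<⇒≤ c<v)) = onTail v c<v v<n

    glueEdges : ∀ (T : EdgeSel G) u w j → w ≤ c → c ≤ j → memb T 0 ≡ true →
                (∀ t → 1 ≤ t → t ≤ c → memb T t ≡ not (gapEdge u w t)) →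
                (∀ t → c < t → t < n → memb T t ≡ (t <ᵇ suc j)) →
                ∀ t → t < n → memb T t ≡ chordSubEdge u w j t
    glueEdges T u w j w≤c c≤j chord onCycle onTail zero    _   = chord
    glueEdges T u w j w≤c c≤j chord onCycle onTail (suc t) t<n with ltView c (suc t)
    ... | is-ge t<c _ = trans (onCycle (suc t) (s≤s z≤n) t<c)
                          (sym (trans (cong (not (gapEdge u w (suc t)) ∧_) (<⇒<ᵇ≡true (s≤s (≤-trans t<c c≤j)))) (∧-identityʳ _)))
    ... | is-lt c<t _ rewrite gapEdge-above {u} {w} {suc t} (≤-<-trans w≤c c<t) = onTail (suc t) c<t t<n

  chordShape : (x : ConnSub G) → memb (ConnSub.eset x) 0 ≡ true → ChordShape x
  chordShape (connSub S T _ inside conn) chord = record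
    { u = u ; w = w ; j = j ; bounds = bounds ; c≤j = c≤j ; j<n = j<n
    ; vset≡ = memb-extensional S _ λ v v<n →
        trans (glueVertices S u w j (w≤c bounds) c≤j (CycleShape.vertices cyc) (TailShape.vertices tl) v v<n)
              (sym (memb-tabulate (chordSubVertex u w j) v v<n))
    ; eset≡ = memb-extensional T _ λ t t<m →
        trans (glueEdges T u w j (w≤c bounds) c≤j chord (CycleShape.edges cyc) (TailShape.edges tl) t
                         (subst (t <_) length-edges t<m))
              (sym (memb-tabulate (chordSubEdge u w j) t t<m)) }
    where
      cyc = cycleShape S T inside conn chord
      tl  = tailShape S T inside conn chord
      open CycleShape cyc using (u; w; bounds)
      open TailShape tl using (j; c≤j; j<n)

-- Connected subgraphs of the dumbbell through its first chord

module Dumbbell (a k b : ℕ) where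

  N : ℕ
  N = a + (k + suc b)

  P : ℕ
  P = a + k

  N-1 : ℕ
  N-1 = a + (k + b)

  open TabGraph N (dumbbellEdge a k b) (suc N) public

  N-1<N : N-1 < N
  N-1<N = +-monoʳ-< a (+-monoʳ-< k (n<1+n b))

  P≤N-1 : P ≤ N-1
  P≤N-1 = +-monoʳ-≤ a (m≤m+n k b)

  a≤P : a ≤ P
  a≤P = m≤m+n a k

  a<N : a < N
  a<N = ≤-<-trans a≤P (≤-<-trans P≤N-1 N-1<N)

  0<N : 0 < N
  0<N = ≤-<-trans z≤n N-1<N

  edge-0 : dumbbellEdge a k b 0 ≡ (a , 0)
  edge-0 = if-false (≢⇒≡ᵇ≡false {0} {N} (λ e → <-irrefl e 0<N))

  edge-suc : ∀ t → suc t < N → dumbbellEdge a k b (suc t) ≡ (t , suc t)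
  edge-suc t p = if-false (≢⇒≡ᵇ≡false (λ e → <-irrefl e p))

  edge-N : dumbbellEdge a k b N ≡ (N-1 , P)
  edge-N = if-true (≡ᵇ-refl N)

  subVertex : ℕ → ℕ → ℕ → ℕ → ℕ → ℕ → Bool
  subVertex u₁ w₁ u₂ w₂ j v = not (gapVertex u₁ w₁ v) ∧ (not (gapVertex u₂ w₂ v) ∧ (v <ᵇ suc j))

  subEdge : Bool → ℕ → ℕ → ℕ → ℕ → ℕ → ℕ → Bool
  subEdge chord₂ u₁ w₁ u₂ w₂ j t =
    (t ≡ᵇ 0) ∨ (((t ≡ᵇ N) ∧ chord₂) ∨ (not (gapEdge u₁ w₁ t) ∧ (not (gapEdge u₂ w₂ t) ∧ (t <ᵇ suc j))))

  record Params : Set where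
    field
      u₁ w₁ u₂ w₂ j : ℕ
      chord₂      : Bool
      u₁≤w₁       : u₁ ≤ w₁
      w₁≤a        : w₁ ≤ a
      a≤j         : a ≤ j
      j<N         : j < N
      chord₂-spec : (chord₂ ≡ false × u₂ ≡ 0 × w₂ ≡ 0)
                  ⊎ (chord₂ ≡ true × j ≡ N-1 × P ≤ u₂ × u₂ ≤ w₂ × w₂ ≤ N-1)

  module Build (p : Params) where
    open Params p

    vset : Vec Bool N
    vset = tabulate (subVertex u₁ w₁ u₂ w₂ j ∘ toℕ)

    eset : EdgeSel G
    eset = tabulate (subEdge chord₂ u₁ w₁ u₂ w₂ j ∘ toℕ)

    memb-vset : ∀ v → v < N → memb vset v ≡ subVertex u₁ w₁ u₂ w₂ j v
    memb-vset v v<N = memb-tabulate (subVertex u₁ w₁ u₂ w₂ j) v v<N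

    memb-eset : ∀ t → t < suc N → memb eset t ≡ subEdge chord₂ u₁ w₁ u₂ w₂ j t
    memb-eset t t≤N = memb-tabulate (subEdge chord₂ u₁ w₁ u₂ w₂ j) t (subst (t <_) (sym length-edges) t≤N)

    gap₂Edge-≤a : ∀ t → t ≤ a → gapEdge u₂ w₂ t ≡ false
    gap₂Edge-≤a t t≤a with chord₂-spec
    ... | inj₁ (_ , refl , refl)      = gapEdge-empty t
    ... | inj₂ (_ , _ , P≤u₂ , _ , _) = gapEdge-below {u₂} {w₂} {t} (≤-trans t≤a (≤-trans a≤P P≤u₂))

    gap₂Vertex-≤a : ∀ v → v ≤ a → gapVertex u₂ w₂ v ≡ false
    gap₂Vertex-≤a v v≤a with chord₂-spec
    ... | inj₁ (_ , refl , refl)      = gapVertex-empty v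
    ... | inj₂ (_ , _ , P≤u₂ , _ , _) = gapVertex-below {u₂} {w₂} {v} (≤-trans v≤a (≤-trans a≤P P≤u₂))

    edge∈eset : ∀ t → 1 ≤ t → t < N → (t ≤ u₁ ⊎ w₁ < t) → gapEdge u₂ w₂ t ≡ false → t ≤ j →
                memb eset t ≡ true
    edge∈eset (suc t) _ t<N out₁ out₂ t≤j
      rewrite memb-eset (suc t) (≤-trans t<N (n≤1+n N)) | ≢⇒≡ᵇ≡false {suc t} {N} (λ e → <-irrefl e t<N)
            | outside⇒¬gapEdge {u₁} {w₁} {suc t} out₁ | out₂ | <⇒<ᵇ≡true (s≤s t≤j) = refl

    vertex∈vset : ∀ v → v < N → (v ≤ u₁ ⊎ w₁ ≤ v) → gapVertex u₂ w₂ v ≡ false → v ≤ j → memb vset v ≡ true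
    vertex∈vset v v<N out₁ out₂ v≤j
      rewrite memb-vset v v<N | outside⇒¬gapVertex {u₁} {w₁} {v} out₁ | out₂ | <⇒<ᵇ≡true (s≤s v≤j) = refl

    chord₁∈eset : memb eset 0 ≡ true
    chord₁∈eset = memb-eset 0 (s≤s z≤n)

    subEdge-N : subEdge chord₂ u₁ w₁ u₂ w₂ j N ≡ chord₂
    subEdge-N rewrite ≢⇒≡ᵇ≡false {N} {0} (λ e → <-irrefl (sym e) 0<N) | ≡ᵇ-refl N | ≤⇒<ᵇ≡false {N} {suc j} j<N
                    | ∧-zeroʳ (not (gapEdge u₂ w₂ N)) | ∧-zeroʳ (not (gapEdge u₁ w₁ N)) = ∨-identityʳ chord₂

    0∈vset : memb vset 0 ≡ true
    0∈vset = vertex∈vset 0 0<N (inj₁ z≤n) (gap₂Vertex-≤a 0 z≤n) z≤n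

    a∈vset : memb vset a ≡ true
    a∈vset = vertex∈vset a a<N (inj₂ w₁≤a) (gap₂Vertex-≤a a ≤-refl) a≤j

    private
      edgeOutside⇒head : ∀ {u w t} → suc t ≤ u ⊎ w < suc t → suc t ≤ u ⊎ w ≤ suc t
      edgeOutside⇒head (inj₁ p) = inj₁ p
      edgeOutside⇒head (inj₂ p) = inj₂ (<⇒≤ p)

      edgeOutside⇒tail : ∀ {u w t} → suc t ≤ u ⊎ w < suc t → t ≤ u ⊎ w ≤ t
      edgeOutside⇒tail {t = t} (inj₁ p) = inj₁ (≤-trans (n≤1+n t) p)
      edgeOutside⇒tail         (inj₂ p) = inj₂ (≤-pred p)

      gap₂-ends : ∀ t → suc t ≤ u₂ ⊎ w₂ < suc t → gapVertex u₂ w₂ t ≡ false × gapVertex u₂ w₂ (suc t) ≡ false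
      gap₂-ends t (inj₁ p) = gapVertex-below {u₂} {w₂} {t} (≤-trans (n≤1+n t) p) , gapVertex-below {u₂} {w₂} {suc t} p
      gap₂-ends t (inj₂ p) = gapVertex-above {u₂} {w₂} {t} (≤-pred p) , gapVertex-above {u₂} {w₂} {suc t} (<⇒≤ p)

      pathEdge-ends : ∀ t → suc t < N → subEdge chord₂ u₁ w₁ u₂ w₂ j (suc t) ≡ true → BothEnds vset (t , suc t)
      pathEdge-ends t t+1<N e rewrite ≢⇒≡ᵇ≡false {suc t} {N} (λ r → <-irrefl r t+1<N) with ∧≡true⇒ e
      ... | out₁ , rest with ∧≡true⇒ rest
      ...   | out₂ , t+1≤j =
        vertex∈vset t (<-trans (n<1+n t) t+1<N) (edgeOutside⇒tail g₁) (proj₁ g₂) (≤-pred (≤-trans (n≤1+n _) t+1≤j′)) ,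
        vertex∈vset (suc t) t+1<N (edgeOutside⇒head g₁) (proj₂ g₂) (≤-pred t+1≤j′)
        where
          g₁ = ¬gapEdge⇒outside u₁ w₁ (suc t) out₁
          g₂ = gap₂-ends t (¬gapEdge⇒outside u₂ w₂ (suc t) out₂)
          t+1≤j′ = <ᵇ≡true⇒< _ _ t+1≤j

      chord₂-ends : subEdge chord₂ u₁ w₁ u₂ w₂ j N ≡ true → BothEnds vset (N-1 , P)
      chord₂-ends e with chord₂-spec
      ... | inj₁ (no₂ , _) = ⊥-elim (true≢false (trans (sym e) (trans subEdge-N no₂)))
      ... | inj₂ (_ , j≡N-1 , P≤u₂ , u₂≤w₂ , w₂≤N-1) =
        vertex∈vset N-1 N-1<N (inj₂ (≤-trans w₁≤a (≤-trans a≤P P≤N-1)))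
                    (gapVertex-above {u₂} {w₂} {N-1} w₂≤N-1) (≤-reflexive (sym j≡N-1)) ,
        vertex∈vset P (≤-<-trans P≤N-1 N-1<N) (inj₂ (≤-trans w₁≤a a≤P))
                    (gapVertex-below {u₂} {w₂} {P} P≤u₂) (≤-trans P≤N-1 (≤-reflexive (sym j≡N-1)))

      selected-ends : ∀ t → t < suc N → subEdge chord₂ u₁ w₁ u₂ w₂ j t ≡ true → BothEnds vset (dumbbellEdge a k b t)
      selected-ends zero _ _ rewrite edge-0 = a∈vset , 0∈vset
      selected-ends (suc t) t<N+1 e with ltView (suc t) N
      ... | is-lt t+1<N _ rewrite edge-suc t t+1<N = pathEdge-ends t t+1<N e
      ... | is-ge N≤t+1 _ =
        subst (λ z → subEdge chord₂ u₁ w₁ u₂ w₂ j z ≡ true → BothEnds vset (dumbbellEdge a k b z))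
              (≤-antisym N≤t+1 (≤-pred t<N+1)) (subst (BothEnds vset) (sym edge-N) ∘ chord₂-ends) e

    inside : EdgesInside vset eset
    inside i e = subst (BothEnds vset) (sym (lookup-edges i))
      (selected-ends (toℕ i) (toℕ<m i) (trans (sym (lookup∘tabulate (subEdge chord₂ u₁ w₁ u₂ w₂ j ∘ toℕ) i)) e))

    open PathWalks (n≤1+n N) edge-suc eset

    private
      1≤ : ∀ {x t} → x < t → 1 ≤ t
      1≤ {t = suc t} _ = s≤s z≤n

      chord₁-step : SelAdj G eset a 0
      chord₁-step = selected⇒SelAdj eset 0 (s≤s z≤n) chord₁∈eset edge-0

      chord₂-step : chord₂ ≡ true → SelAdj G eset N-1 P
      chord₂-step yes₂ = selected⇒SelAdj eset N ≤-refl (trans (memb-eset N ≤-refl) (trans subEdge-N yes₂)) edge-N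

      walk-via-chord₁ : ∀ R → a ≤ R → R ≤ j → R < N → (∀ t → t ≤ R → gapEdge u₂ w₂ t ≡ false) →
                        ∀ v → w₁ ≤ v → v ≤ R → Walk G eset v 0
      walk-via-chord₁ R a≤R R≤j R<N no-gap₂ v w₁≤v v≤R = walk-++ to-a (step chord₁-step here)
        where
          to-a : Walk G eset v a
          to-a with ≤-total v a
          ... | inj₁ v≤a = walk-up v a v≤a a<N λ t v<t t≤a →
                  edge∈eset t (1≤ v<t) (≤-<-trans t≤a a<N) (inj₂ (≤-<-trans w₁≤v v<t))
                            (no-gap₂ t (≤-trans t≤a a≤R)) (≤-trans t≤a a≤j)
          ... | inj₂ a≤v = walk-down a v a≤v (≤-<-trans v≤R R<N) λ t a<t t≤v →
                  edge∈eset t (1≤ a<t) (≤-<-trans t≤v (≤-<-trans v≤R R<N)) (inj₂ (≤-<-trans w₁≤a a<t))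
                            (no-gap₂ t (≤-trans t≤v v≤R)) (≤-trans t≤v (≤-trans v≤R R≤j))

      walk-through-chord₂ : chord₂ ≡ true → j ≡ N-1 → P ≤ u₂ → u₂ ≤ w₂ → w₂ ≤ N-1 →
                            ∀ v → w₁ ≤ v → v ≤ u₂ ⊎ w₂ ≤ v → v ≤ j → Walk G eset v 0
      walk-through-chord₂ yes₂ j≡N-1 P≤u₂ u₂≤w₂ w₂≤N-1 = λ where
          v w₁≤v (inj₁ v≤u₂) _ → from-first-cycle v w₁≤v v≤u₂
          v w₁≤v (inj₂ w₂≤v) v≤j → walk-++ (walk-up v N-1 (≤-trans v≤j N-1≥j) N-1<N λ t v<t t≤N-1 →
                                             edge∈eset t (1≤ v<t) (≤-<-trans t≤N-1 N-1<N)
                                               (inj₂ (≤-<-trans (≤-trans w₁≤a (≤-trans a≤u₂ (≤-trans u₂≤w₂ w₂≤v))) v<t))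
                                               (gapEdge-above {u₂} {w₂} {t} (≤-<-trans w₂≤v v<t)) (≤-trans t≤N-1 N-1≤j))
                                  (step (chord₂-step yes₂) (from-first-cycle P (≤-trans w₁≤a a≤P) P≤u₂))
        where
          N-1≤j = ≤-reflexive (sym j≡N-1)
          N-1≥j = ≤-reflexive j≡N-1
          a≤u₂ = ≤-trans a≤P P≤u₂
          u₂≤j = ≤-trans u₂≤w₂ (≤-trans w₂≤N-1 N-1≤j)
          u₂<N = ≤-<-trans u₂≤w₂ (≤-<-trans w₂≤N-1 N-1<N)
          from-first-cycle : ∀ v → w₁ ≤ v → v ≤ u₂ → Walk G eset v 0
          from-first-cycle = walk-via-chord₁ u₂ a≤u₂ u₂≤j u₂<N (λ t → gapEdge-below {u₂} {w₂} {t})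

      walk-to-0 : ∀ v → memb vset v ≡ true → Walk G eset v 0
      walk-to-0 v v∈ with ∧≡true⇒ (trans (sym (memb-vset v (memb⇒< vset v v∈))) v∈)
      ... | out₁ , rest with ∧≡true⇒ rest
      ...   | out₂ , v≤j′ = from (¬gapVertex⇒outside u₁ w₁ v out₁)
        where
          v<N = memb⇒< vset v v∈
          v≤j : v ≤ j
          v≤j = ≤-pred (<ᵇ≡true⇒< _ _ v≤j′)
          from : v ≤ u₁ ⊎ w₁ ≤ v → Walk G eset v 0
          from (inj₁ v≤u₁) = walk-down 0 v z≤n v<N λ t 0<t t≤v →
            edge∈eset t (1≤ 0<t) (≤-<-trans t≤v v<N) (inj₁ (≤-trans t≤v v≤u₁))
                      (gap₂Edge-≤a t (≤-trans t≤v (≤-trans v≤u₁ (≤-trans u₁≤w₁ w₁≤a)))) (≤-trans t≤v v≤j)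
          from (inj₂ w₁≤v) with chord₂-spec
          ... | inj₁ (_ , refl , refl) = walk-via-chord₁ j a≤j ≤-refl j<N (λ t _ → gapEdge-empty t) v w₁≤v v≤j
          ... | inj₂ (yes₂ , j≡N-1 , P≤u₂ , u₂≤w₂ , w₂≤N-1) =
            walk-through-chord₂ yes₂ j≡N-1 P≤u₂ u₂≤w₂ w₂≤N-1 v w₁≤v (¬gapVertex⇒outside u₂ w₂ v out₂) v≤j

    connected : Connected vset eset
    connected u v u∈ v∈ = walk-++ (walk-to-0 u u∈) (walk-reverse (walk-to-0 v v∈))

    nonempty : Σ (Fin N) λ i → Vec.lookup vset i ≡ true
    nonempty = fromℕ< 0<N , trans (sym (memb-lookup vset _)) (trans (cong (memb vset) (toℕ-fromℕ< 0<N)) 0∈vset)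

  build : Params → ConnSub G
  build p = connSub vset eset nonempty inside connected
    where open Build p

Pair : ℕ → Set
Pair zero    = ⊥
Pair (suc c) = Pair c ⊎ Fin c

choose2 : ℕ → ℕ
choose2 zero    = 0
choose2 (suc c) = choose2 c + c

Fin-choose2↔Pair : ∀ c → Fin (choose2 c) ↔ Pair c
Fin-choose2↔Pair zero    = 0↔⊥
Fin-choose2↔Pair (suc c) = ↔-trans (+↔⊎ {choose2 c} {c}) (Fin-choose2↔Pair c ⊎-↔ ↔-refl)

pairToℕ : ∀ {c} → Pair c → ℕ × ℕ
pairToℕ {suc c} (inj₁ p) = pairToℕ p
pairToℕ {suc c} (inj₂ i) = (toℕ i , c)

pairToℕ-< : ∀ {c} (p : Pair c) → proj₁ (pairToℕ p) < proj₂ (pairToℕ p) × proj₂ (pairToℕ p) < c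
pairToℕ-< {suc c} (inj₁ p) = proj₁ (pairToℕ-< p) , <-trans (proj₂ (pairToℕ-< p)) (n<1+n c)
pairToℕ-< {suc c} (inj₂ i) = toℕ<n i , n<1+n c

pairToℕ-injective : ∀ {c} (p q : Pair c) → pairToℕ p ≡ pairToℕ q → p ≡ q
pairToℕ-injective {suc c} (inj₁ p) (inj₁ q) e = cong inj₁ (pairToℕ-injective p q e)
pairToℕ-injective {suc c} (inj₂ i) (inj₂ j) e = cong inj₂ (toℕ-injective (cong proj₁ e))
pairToℕ-injective {suc c} (inj₁ p) (inj₂ j) e = ⊥-elim (<-irrefl (cong proj₂ e) (proj₂ (pairToℕ-< p)))
pairToℕ-injective {suc c} (inj₂ i) (inj₁ q) e = ⊥-elim (<-irrefl (sym (cong proj₂ e)) (proj₂ (pairToℕ-< q)))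

pairFromℕ : ∀ {c} u w → u < w → w < c → Σ (Pair c) λ p → pairToℕ p ≡ (u , w)
pairFromℕ {suc c} u w u<w w<c+1 with ltView w c
... | is-lt w<c _ = let (p , e) = pairFromℕ u w u<w w<c in inj₁ p , e
... | is-ge c≤w _ = inj₂ (fromℕ< (<-≤-trans u<w (≤-pred w<c+1))) ,
                    cong₂ _,_ (toℕ-fromℕ< _) (≤-antisym c≤w (≤-pred w<c+1))

Gap : ℕ → Set
Gap c = Fin 1 ⊎ Pair c

Fin↔Gap : ∀ c → Fin (1 + choose2 c) ↔ Gap c
Fin↔Gap c = ↔-trans (+↔⊎ {1} {choose2 c}) (↔-refl ⊎-↔ Fin-choose2↔Pair c)

gapAt : ∀ {c} → ℕ → Gap c → ℕ × ℕ
gapAt L (inj₁ _) = (L , L)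
gapAt L (inj₂ p) = (L + proj₁ (pairToℕ p) , L + proj₂ (pairToℕ p))

gapAt-within : ∀ {c} L (g : Gap (suc c)) → GapWithin L (L + c) (proj₁ (gapAt L g)) (proj₂ (gapAt L g))
gapAt-within L (inj₁ _) = inj₁ (refl , refl)
gapAt-within L (inj₂ p) = let (u<w , w<c) = pairToℕ-< p in
  inj₂ (m≤m+n L _ , +-monoʳ-< L u<w , +-monoʳ-≤ L (≤-pred w<c))

gapAt-injective : ∀ {c} L (g h : Gap c) → gapAt L g ≡ gapAt L h → g ≡ h
gapAt-injective L (inj₁ fzero) (inj₁ fzero) e = refl
gapAt-injective L (inj₂ p) (inj₂ q) e =
  cong inj₂ (pairToℕ-injective p q (cong₂ _,_ (+-cancelˡ-≡ L _ _ (cong proj₁ e)) (+-cancelˡ-≡ L _ _ (cong proj₂ e))))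
gapAt-injective L (inj₁ _) (inj₂ q) e = ⊥-elim (nonempty q (sym (cong proj₁ e)) (sym (cong proj₂ e)))
  where
    nonempty : ∀ {c} (q : Pair c) → L + proj₁ (pairToℕ q) ≡ L → L + proj₂ (pairToℕ q) ≡ L → ⊥
    nonempty q e₁ e₂ = <-irrefl (trans e₁ (sym e₂)) (+-monoʳ-< L (proj₁ (pairToℕ-< q)))
gapAt-injective L (inj₂ p) (inj₁ _) e = ⊥-elim (nonempty p (cong proj₁ e) (cong proj₂ e))
  where
    nonempty : ∀ {c} (q : Pair c) → L + proj₁ (pairToℕ q) ≡ L → L + proj₂ (pairToℕ q) ≡ L → ⊥
    nonempty q e₁ e₂ = <-irrefl (trans e₁ (sym e₂)) (+-monoʳ-< L (proj₁ (pairToℕ-< q)))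

gapFromℕ : ∀ {c u w} → GapWithin 0 c u w → Σ (Gap (suc c)) λ g → gapAt 0 g ≡ (u , w)
gapFromℕ (inj₁ (refl , refl))     = inj₁ fzero , refl
gapFromℕ (inj₂ (_ , u<w , w≤c)) = inj₂ (proj₁ (pairFromℕ _ _ u<w (s≤s w≤c))) , proj₂ (pairFromℕ _ _ u<w (s≤s w≤c))

gapEdge-injective : ∀ L R u w u′ w′ → GapWithin L R u w → GapWithin L R u′ w′ →
                    (∀ t → L < t → t ≤ R → gapEdge u w t ≡ gapEdge u′ w′ t) → (u , w) ≡ (u′ , w′)
gapEdge-injective L R u w u′ w′ (inj₁ (refl , refl)) (inj₁ (refl , refl)) h = refl
gapEdge-injective L R u w u′ w′ (inj₁ (refl , refl)) (inj₂ (L≤u′ , u′<w′ , w′≤R)) h =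
  ⊥-elim (true≢false (trans (sym (gapEdge-inside {u′} {w′} {suc u′} ≤-refl u′<w′))
    (trans (sym (h (suc u′) (s≤s L≤u′) (≤-trans u′<w′ w′≤R))) (gapEdge-above {u} {u} {suc u′} (s≤s L≤u′)))))
gapEdge-injective L R u w u′ w′ (inj₂ (L≤u , u<w , w≤R)) (inj₁ (refl , refl)) h =
  ⊥-elim (true≢false (trans (sym (gapEdge-inside {u} {w} {suc u} ≤-refl u<w))
    (trans (h (suc u) (s≤s L≤u) (≤-trans u<w w≤R)) (gapEdge-above {u′} {u′} {suc u} (s≤s L≤u)))))
gapEdge-injective L R u w u′ w′ (inj₂ (L≤u , u<w , w≤R)) (inj₂ (L≤u′ , u′<w′ , w′≤R)) h with <-cmp u u′
... | tri< u<u′ _ _ = ⊥-elim (true≢false (trans (sym (gapEdge-inside {u} {w} {suc u} ≤-refl u<w))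
        (trans (h (suc u) (s≤s L≤u) (≤-trans u<w w≤R)) (gapEdge-below {u′} {w′} {suc u} u<u′))))
... | tri> _ _ u′<u = ⊥-elim (true≢false (trans (sym (gapEdge-inside {u′} {w′} {suc u′} ≤-refl u′<w′))
        (trans (sym (h (suc u′) (s≤s L≤u′) (≤-trans u′<w′ w′≤R))) (gapEdge-below {u} {w} {suc u′} u′<u))))
... | tri≈ _ refl _ with <-cmp w w′
...   | tri< w<w′ _ _ = ⊥-elim (true≢false (trans (sym (gapEdge-inside {u} {w′} {w′} u′<w′ ≤-refl))
          (trans (sym (h w′ (≤-<-trans L≤u u′<w′) w′≤R)) (gapEdge-above {u} {w} {w′} w<w′))))
...   | tri> _ _ w′<w = ⊥-elim (true≢false (trans (sym (gapEdge-inside {u} {w} {w} u<w ≤-refl))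
          (trans (h w (≤-<-trans L≤u u<w) w≤R) (gapEdge-above {u} {w′} {w} w′<w))))
...   | tri≈ _ refl _ = refl

GapWithin⇒≤ : ∀ {L R u w} → L ≤ R → GapWithin L R u w → L ≤ u × u ≤ w × w ≤ R
GapWithin⇒≤ L≤R (inj₁ (refl , refl))     = ≤-refl , ≤-refl , L≤R
GapWithin⇒≤ L≤R (inj₂ (L≤u , u<w , w≤R)) = L≤u , <⇒≤ u<w , w≤R

module DumbbellCode (a k b : ℕ) where
  open Dumbbell a k b

  -- The second component is either the path end a + r (second chord absent) or the gap in the
  -- second cycle (whole path and second chord present).
  Code : Set
  Code = Gap (suc a) × (Fin (k + suc b) ⊎ Gap (suc b))

  private
    gap₁-within : (g : Gap (suc a)) → GapWithin 0 a (proj₁ (gapAt 0 g)) (proj₂ (gapAt 0 g))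
    gap₁-within g = gapAt-within 0 g

    gap₁-≤ : (g : Gap (suc a)) → 0 ≤ proj₁ (gapAt 0 g) × proj₁ (gapAt 0 g) ≤ proj₂ (gapAt 0 g) × proj₂ (gapAt 0 g) ≤ a
    gap₁-≤ g = GapWithin⇒≤ z≤n (gap₁-within g)

    gap₂-within : (g : Gap (suc b)) → GapWithin P N-1 (proj₁ (gapAt P g)) (proj₂ (gapAt P g))
    gap₂-within g = subst (λ R → GapWithin P R (proj₁ (gapAt P g)) (proj₂ (gapAt P g))) (+-assoc a k b) (gapAt-within P g)

    gap₂-≤ : (g : Gap (suc b)) →
             P ≤ proj₁ (gapAt P g) × proj₁ (gapAt P g) ≤ proj₂ (gapAt P g) × proj₂ (gapAt P g) ≤ N-1
    gap₂-≤ g = GapWithin⇒≤ P≤N-1 (gap₂-within g)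

  paramsOf : Code → Params
  paramsOf (g , inj₁ r) = record
    { u₁ = proj₁ (gapAt 0 g) ; w₁ = proj₂ (gapAt 0 g) ; u₂ = 0 ; w₂ = 0 ; j = a + toℕ r ; chord₂ = false
    ; u₁≤w₁ = proj₁ (proj₂ (gap₁-≤ g)) ; w₁≤a = proj₂ (proj₂ (gap₁-≤ g))
    ; a≤j = m≤m+n a _ ; j<N = +-monoʳ-< a (toℕ<n r) ; chord₂-spec = inj₁ (refl , refl , refl) }
  paramsOf (g , inj₂ g₂) = record
    { u₁ = proj₁ (gapAt 0 g) ; w₁ = proj₂ (gapAt 0 g) ; u₂ = proj₁ (gapAt P g₂) ; w₂ = proj₂ (gapAt P g₂)
    ; j = N-1 ; chord₂ = true
    ; u₁≤w₁ = proj₁ (proj₂ (gap₁-≤ g)) ; w₁≤a = proj₂ (proj₂ (gap₁-≤ g))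
    ; a≤j = ≤-trans a≤P P≤N-1 ; j<N = N-1<N
    ; chord₂-spec = let (P≤u₂ , u₂≤w₂ , w₂≤N-1) = gap₂-≤ g₂ in inj₂ (refl , refl , P≤u₂ , u₂≤w₂ , w₂≤N-1) }

  subgraph : Code → ConnSub G
  subgraph = build ∘ paramsOf

  private
    sel : Code → ℕ → Bool
    sel c = subEdge chord₂ u₁ w₁ u₂ w₂ j
      where open Params (paramsOf c)

    memb-subgraph : ∀ c t → t < suc N → memb (ConnSub.eset (subgraph c)) t ≡ sel c t
    memb-subgraph c = Build.memb-eset (paramsOf c)

    sel-N : ∀ c → sel c N ≡ Params.chord₂ (paramsOf c)
    sel-N c = Build.subEdge-N (paramsOf c)

    sel-firstCycle : ∀ c t → 1 ≤ t → t ≤ a →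
                     sel c t ≡ not (gapEdge (proj₁ (gapAt 0 (proj₁ c))) (proj₂ (gapAt 0 (proj₁ c))) t)
    sel-firstCycle (g , x) (suc t) _ t<a = trans (lemma x) (∧-identityʳ _)
      where
        lemma : ∀ x → sel (g , x) (suc t) ≡ not (gapEdge (proj₁ (gapAt 0 g)) (proj₂ (gapAt 0 g)) (suc t)) ∧ true
        lemma x rewrite ≢⇒≡ᵇ≡false {suc t} {N} (λ e → <-irrefl e (≤-<-trans t<a a<N))
                      | Build.gap₂Edge-≤a (paramsOf (g , x)) (suc t) t<a
                      | <⇒<ᵇ≡true (s≤s (≤-trans t<a (Params.a≤j (paramsOf (g , x))))) with x
        ... | inj₁ _ = refl
        ... | inj₂ _ = refl

    sel-path : ∀ g r t → a < t → t < N → sel (g , inj₁ r) t ≡ (t <ᵇ suc (a + toℕ r))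
    sel-path g r (suc t) a<t t<N
      rewrite ≢⇒≡ᵇ≡false {suc t} {N} (λ e → <-irrefl e t<N)
            | gapEdge-above {proj₁ (gapAt 0 g)} {proj₂ (gapAt 0 g)} {suc t} (≤-<-trans (proj₂ (proj₂ (gap₁-≤ g))) a<t) = refl

    sel-secondCycle : ∀ g g₂ t → P < t → t ≤ N-1 →
                      sel (g , inj₂ g₂) t ≡ not (gapEdge (proj₁ (gapAt P g₂)) (proj₂ (gapAt P g₂)) t)
    sel-secondCycle g g₂ (suc t) P<t t≤N-1
      rewrite ≢⇒≡ᵇ≡false {suc t} {N} (λ e → <-irrefl e (≤-<-trans t≤N-1 N-1<N))
            | gapEdge-above {proj₁ (gapAt 0 g)} {proj₂ (gapAt 0 g)} {suc t}
                            (≤-<-trans (≤-trans (proj₂ (proj₂ (gap₁-≤ g))) a≤P) P<t)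
            | <⇒<ᵇ≡true (s≤s t≤N-1) = ∧-identityʳ _

    same-chord₂ : ∀ c c′ → (∀ t → t < suc N → sel c t ≡ sel c′ t) →
                  Params.chord₂ (paramsOf c) ≡ Params.chord₂ (paramsOf c′)
    same-chord₂ c c′ h = trans (sym (sel-N c)) (trans (h N ≤-refl) (sel-N c′))

    same-gap₁ : ∀ c c′ → (∀ t → t < suc N → sel c t ≡ sel c′ t) → proj₁ c ≡ proj₁ c′
    same-gap₁ c c′ h = gapAt-injective 0 (proj₁ c) (proj₁ c′)
      (gapEdge-injective 0 a _ _ _ _ (gap₁-within (proj₁ c)) (gap₁-within (proj₁ c′)) λ t 0<t t≤a →
        not-injective (trans (sym (sel-firstCycle c t 0<t t≤a))
          (trans (h t (s≤s (≤-trans t≤a (<⇒≤ a<N)))) (sel-firstCycle c′ t 0<t t≤a))))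

    same-pathEnd : ∀ g r r′ → (∀ t → t < suc N → sel (g , inj₁ r) t ≡ sel (g , inj₁ r′) t) → r ≡ r′
    same-pathEnd g r r′ h =
      toℕ-injective (+-cancelˡ-≡ a _ _ (≤-antisym (≤-by r r′ h) (≤-by r′ r (λ t p → sym (h t p)))))
      where
        ≤-by : ∀ r r′ → (∀ t → t < suc N → sel (g , inj₁ r) t ≡ sel (g , inj₁ r′) t) → a + toℕ r ≤ a + toℕ r′
        ≤-by r r′ h with ltView (a + toℕ r′) (a + toℕ r)
        ... | is-ge r≤r′ _ = r≤r′
        ... | is-lt r′<r _ = ⊥-elim (true≢false (trans (sym (<⇒<ᵇ≡true (s≤s (≤-refl {a + toℕ r}))))
                (trans (sym (sel-path g r _ a<j j<N)) (trans (h _ (≤-trans j<N (n≤1+n N)))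
                  (trans (sel-path g r′ _ a<j j<N) (≤⇒<ᵇ≡false (s≤s r′<r)))))))
          where
            a<j = ≤-<-trans (m≤m+n a (toℕ r′)) r′<r
            j<N = +-monoʳ-< a (toℕ<n r)

    same-gap₂ : ∀ g g₂ g₂′ → (∀ t → t < suc N → sel (g , inj₂ g₂) t ≡ sel (g , inj₂ g₂′) t) → g₂ ≡ g₂′
    same-gap₂ g g₂ g₂′ h = gapAt-injective P g₂ g₂′
      (gapEdge-injective P N-1 _ _ _ _ (gap₂-within g₂) (gap₂-within g₂′) λ t P<t t≤N-1 →
        not-injective (trans (sym (sel-secondCycle g g₂ t P<t t≤N-1))
          (trans (h t (s≤s (≤-trans t≤N-1 (<⇒≤ N-1<N)))) (sel-secondCycle g g₂′ t P<t t≤N-1))))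

    sel-injective : ∀ c c′ → (∀ t → t < suc N → sel c t ≡ sel c′ t) → c ≡ c′
    sel-injective c c′ h with same-gap₁ c c′ h
    sel-injective (g , inj₁ r)  (.g , inj₁ r′)  h | refl = cong (λ r → g , inj₁ r) (same-pathEnd g r r′ h)
    sel-injective (g , inj₂ g₂) (.g , inj₂ g₂′) h | refl = cong (λ g₂ → g , inj₂ g₂) (same-gap₂ g g₂ g₂′ h)
    sel-injective (g , inj₁ r)  (.g , inj₂ g₂′) h | refl =
      ⊥-elim (true≢false (sym (same-chord₂ (g , inj₁ r) (g , inj₂ g₂′) h)))
    sel-injective (g , inj₂ g₂) (.g , inj₁ r′)  h | refl =
      ⊥-elim (true≢false (same-chord₂ (g , inj₂ g₂) (g , inj₁ r′) h))

  subgraph-injective : ∀ c c′ → subgraph c ≡ subgraph c′ → c ≡ c′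
  subgraph-injective c c′ e = sel-injective c c′ λ t t≤N →
    trans (sym (memb-subgraph c t t≤N)) (trans (cong (λ x → memb (ConnSub.eset x) t) e) (memb-subgraph c′ t t≤N))

  subgraph-chord₁ : ∀ c → memb (ConnSub.eset (subgraph c)) 0 ≡ true
  subgraph-chord₁ c = Build.chord₁∈eset (paramsOf c)

2*choose2+n≡n*n : ∀ n → 2 * choose2 n + n ≡ n * n
2*choose2+n≡n*n zero    = refl
2*choose2+n≡n*n (suc n) = begin
  2 * (choose2 n + n) + suc n       ≡⟨ regroup (choose2 n) n ⟩
  (2 * choose2 n + n) + 2 * n + 1   ≡⟨ cong (λ z → z + 2 * n + 1) (2*choose2+n≡n*n n) ⟩
  n * n + 2 * n + 1                 ≡⟨ square n ⟩
  suc n * suc n                     ∎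
  where
    open ≡-Reasoning
    regroup : ∀ p n → 2 * (p + n) + suc n ≡ 2 * p + n + 2 * n + 1
    regroup = solve-∀
    square : ∀ n → n * n + 2 * n + 1 ≡ suc n * suc n
    square = solve-∀

choose2-+ : ∀ m n → choose2 (m + n) ≡ choose2 m + choose2 n + m * n
choose2-+ m zero rewrite +-identityʳ m | *-zeroʳ m | +-identityʳ (choose2 m) = sym (+-identityʳ (choose2 m))
choose2-+ m (suc n) rewrite +-suc m n | choose2-+ m n = regroup (choose2 m) (choose2 n) m n
  where
    regroup : ∀ p q m n → p + q + m * n + (m + n) ≡ p + (q + n) + m * suc n
    regroup = solve-∀

3+n≤choose2[3+n] : ∀ n → 3 + n ≤ choose2 (3 + n)
3+n≤choose2[3+n] n = *-cancelˡ-≤ 2 (+-cancelʳ-≤ (3 + n) _ _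
  (subst (2 * (3 + n) + (3 + n) ≤_) (sym (2*choose2+n≡n*n (3 + n)))
    (subst (_≤ (3 + n) * (3 + n)) (sym (times3 n)) (*-monoʳ-≤ (3 + n) (m≤m+n 3 n)))))
  where
    times3 : ∀ n → 2 * (3 + n) + (3 + n) ≡ (3 + n) * 3
    times3 = solve-∀

2*choose2[3+n] : ∀ n → 2 * choose2 (3 + n) ≡ (3 + n) * (2 + n)
2*choose2[3+n] n = +-cancelʳ-≡ (3 + n) _ _ (trans (2*choose2+n≡n*n (3 + n)) (split n))
  where
    split : ∀ n → (3 + n) * (3 + n) ≡ (3 + n) * (2 + n) + (3 + n)
    split = solve-∀

count-inequality : ∀ x y k → k ≤ 2 + x →
  (1 + choose2 ((2 + x) + (2 + y))) * (2 + k) < (1 + choose2 (3 + x)) * ((k + (3 + y)) + (1 + choose2 (3 + y)))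
count-inequality x y k k≤a = begin-strict
  (1 + choose2 ((2 + x) + (2 + y))) * K  ≡⟨ cong (λ z → (1 + choose2 z) * K) (shift x y) ⟩
  (1 + choose2 (M + β)) * K              ≡⟨ cong (λ z → (1 + z) * K) (choose2-+ M β) ⟩
  (1 + (p + X + M * β)) * K              ≡⟨ expand p X M β K ⟩
  Q * K + X * K + M * β * K              ≤⟨ +-mono-≤ (+-monoʳ-≤ (Q * K) (*-monoʳ-≤ X K≤Q)) (*-monoʳ-≤ (M * β) K≤M+1) ⟩
  Q * K + X * Q + M * β * (M + 1)        <⟨ +-monoʳ-< (Q * K + X * Q) key ⟩
  Q * K + X * Q + Q * (3 * y + 5)        ≡⟨ collect p X y k ⟩
  Q * ((k + (3 + y)) + (1 + choose2 (3 + y))) ∎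
  where
    open ≤-Reasoning
    M = 3 + x
    β = 1 + y
    K = 2 + k
    p = choose2 M
    X = choose2 β
    Q = 1 + p
    shift : ∀ x y → (2 + x) + (2 + y) ≡ (3 + x) + (1 + y)
    shift = solve-∀
    expand : ∀ p X M β K → (1 + (p + X + M * β)) * K ≡ (1 + p) * K + X * K + M * β * K
    expand = solve-∀
    collect : ∀ p X y k → (1 + p) * (2 + k) + X * (1 + p) + (1 + p) * (3 * y + 5)
                          ≡ (1 + p) * ((k + (3 + y)) + (1 + (X + (1 + y) + (2 + y))))
    collect = solve-∀
    K≤M+1 : K ≤ M + 1
    K≤M+1 = subst (K ≤_) (+-comm 1 M) (s≤s (s≤s k≤a))
    K≤Q : K ≤ Q
    K≤Q = ≤-trans K≤M+1 (subst (_≤ Q) (+-comm 1 M) (s≤s (3+n≤choose2[3+n] x)))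
    -- 2Q(3y+5) = (2 + M(M-1))(3y+5) exceeds 2Mβ(M+1) by a polynomial with positive constant term.
    excess : ∀ x y → (2 + (3 + x) * (2 + x)) * (3 * y + 5)
                     ≡ 2 * ((3 + x) * (1 + y) * ((3 + x) + 1)) + ((1 + y) * x * x + (1 + y) * x + 2 * x * x + 10 * x + 16)
    excess = solve-∀
    2Q≡ : 2 * Q * (3 * y + 5) ≡ (2 + (3 + x) * (2 + x)) * (3 * y + 5)
    2Q≡ = cong (_* (3 * y + 5)) (trans (*-distribˡ-+ 2 1 p) (cong (2 +_) (2*choose2[3+n] x)))
    key : M * β * (M + 1) < Q * (3 * y + 5)
    key = *-cancelˡ-< 2 _ _ (subst (2 * (M * β * (M + 1)) <_) (sym (trans (sym (*-assoc 2 Q (3 * y + 5))) (trans 2Q≡ (excess x y))))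
            (m<m+n (2 * (M * β * (M + 1))) (≤-trans (s≤s z≤n) (m≤n+m 16 ((1 + y) * x * x + (1 + y) * x + 2 * x * x + 10 * x)))))

-- Injecting the connected subgraphs of L into those of C

pathEdges-linked : ∀ (xs : List ℕ) → Linked (λ u v → (u , v) ∈ pathEdges xs) xs
pathEdges-linked []           = []
pathEdges-linked (x ∷ [])     = [-]
pathEdges-linked (x ∷ y ∷ vs) = here refl ∷ Linked.map there (pathEdges-linked (y ∷ vs))

girth⇒k≤m₁ : ∀ m₁ m₂ k → 3 ≤ m₁ → GirthAtLeast (Cmm m₁ m₂ k) k → k ≤ m₁
girth⇒k≤m₁ (suc m) m₂ k 3≤m₁ girth = subst (k ≤_) (length-upTo (suc m)) (girth (upTo (suc m)) firstCycle)
  where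
    firstCycle : IsCycle (Cmm (suc m) m₂ k) (upTo (suc m))
    firstCycle = record
      { long     = subst (3 ≤_) (sym (length-upTo (suc m))) 3≤m₁
      ; distinct = upTo⁺ (suc m)
      ; closed   = Linked.map (inj₁ ∘ ∈-++⁺ˡ) (pathEdges-linked (upTo (suc m) ++ (0 ∷ [])))
      }

injective-missing⇒< : ∀ {A B : Set} {m n : ℕ} → Fin m ↔ A → Fin n ↔ B →
                      (f : A → B) → (∀ x y → f x ≡ f y → x ≡ y) → (y₀ : B) → (∀ x → f x ≢ y₀) → m < n
injective-missing⇒< {m = m} A↔ B↔ f f-inj y₀ y₀∉ = injective⇒≤ {f = g} (g-inj _ _)
  where
    toA = Inverse.to A↔
    fromB = Inverse.from B↔
    toA-inj = Injection.injective (↔⇒↣ A↔)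
    fromB-inj = Injection.injective (↔⇒↣ (↔-sym B↔))
    g : Fin (suc m) → Fin _
    g fzero    = fromB y₀
    g (fsuc i) = fromB (f (toA i))
    g-inj : ∀ i j → g i ≡ g j → i ≡ j
    g-inj fzero    fzero    _ = refl
    g-inj fzero    (fsuc j) e = ⊥-elim (y₀∉ _ (sym (fromB-inj e)))
    g-inj (fsuc i) fzero    e = ⊥-elim (y₀∉ _ (fromB-inj e))
    g-inj (fsuc i) (fsuc j) e = cong fsuc (toA-inj (f-inj _ _ (fromB-inj e)))

module LollipopIntoDumbbell (x y k : ℕ) (k≤a : k ≤ 2 + x) where

  a b c : ℕ
  a = 2 + x
  b = 2 + y
  c = suc x + b

  open Dumbbell a k b using (N; edge-suc) renaming (G to DumbbellGraph)
  open DumbbellCode a k b using (Code; subgraph; subgraph-injective; subgraph-chord₁)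

  c+1<N : suc c < N
  c+1<N = +-monoʳ-< a (≤-trans (n<1+n b) (m≤n+m (suc b) k))

  open Lollipop c N c+1<N using (ChordShape; chordShape; chordSubVertex; chordSubEdge)
  open TabGraph N (lollipopEdge c) N using () renaming (G to LollipopGraph)

  module Chordless = Transport N N (suc N) (lollipopEdge c) (dumbbellEdge a k b) (n≤1+n N)
                       id id (λ _ v<N → v<N) (λ _ _ → refl) (λ _ _ → refl)

  edge0 : ∀ {G} → ConnSub G → Bool
  edge0 x = memb (ConnSub.eset x) 0

  chordless-preserved : (z : ConnSub LollipopGraph) → edge0 z ≡ false → Chordless.Preserves (ConnSub.eset z)
  chordless-preserved z no-chord zero    _   chord = ⊥-elim (true≢false (trans (sym chord) no-chord))
  chordless-preserved z no-chord (suc t) t<N _     = edge-suc t t<N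

  LollipopCode : Set
  LollipopCode = Gap (suc c) × Fin (2 + k)

  N≡c+2+k : N ≡ c + (2 + k)
  N≡c+2+k = identity x y k
    where
      identity : ∀ x y k → 2 + x + (k + suc (2 + y)) ≡ suc x + (2 + y) + (2 + k)
      identity = solve-∀

  pathEndFromℕ : ∀ j → c ≤ j → j < N → Σ (Fin (2 + k)) λ s → c + toℕ s ≡ j
  pathEndFromℕ j c≤j j<N = fromℕ< j∸c<2+k , trans (cong (c +_) (toℕ-fromℕ< j∸c<2+k)) (m+[n∸m]≡n c≤j)
    where
      j∸c<2+k : j ∸ c < 2 + k
      j∸c<2+k = +-cancelˡ-< c _ _ (subst₂ _<_ (sym (m+[n∸m]≡n c≤j)) N≡c+2+k j<N)

  codeOf : ∀ {z} → ChordShape z → LollipopCode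
  codeOf s = proj₁ (gapFromℕ bounds) , proj₁ (pathEndFromℕ j c≤j j<n)
    where open ChordShape s

  codeOf-injective : ∀ {z z′} (s : ChordShape z) (s′ : ChordShape z′) → codeOf s ≡ codeOf s′ → z ≡ z′
  codeOf-injective s s′ e = ConnSub-≡
    (trans (vset≡ s) (trans (cong (λ (u , w , j) → tabulate (chordSubVertex u w j ∘ toℕ)) uwj≡) (sym (vset≡ s′))))
    (trans (eset≡ s) (trans (cong (λ (u , w , j) → tabulate (chordSubEdge u w j ∘ toℕ)) uwj≡) (sym (eset≡ s′))))
    where
      open ChordShape
      uw≡ : (u s , w s) ≡ (u s′ , w s′)
      uw≡ = trans (sym (proj₂ (gapFromℕ (bounds s))))
              (trans (cong (gapAt 0 ∘ proj₁) e) (proj₂ (gapFromℕ (bounds s′))))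
      j≡ : j s ≡ j s′
      j≡ = trans (sym (proj₂ (pathEndFromℕ (j s) (c≤j s) (j<n s))))
             (trans (cong ((c +_) ∘ toℕ ∘ proj₂) e) (proj₂ (pathEndFromℕ (j s′) (c≤j s′) (j<n s′))))
      uwj≡ : (u s , w s , j s) ≡ (u s′ , w s′ , j s′)
      uwj≡ = cong₂ (λ (u , w) j → (u , w , j)) uw≡ j≡

  lollipopCount dumbbellCount : ℕ
  lollipopCount = (1 + choose2 (suc c)) * (2 + k)
  dumbbellCount = (1 + choose2 (suc a)) * ((k + suc b) + (1 + choose2 (suc b)))

  Fin↔LollipopCode : Fin lollipopCount ↔ LollipopCode
  Fin↔LollipopCode = ↔-trans (*↔× {1 + choose2 (suc c)} {2 + k}) (Fin↔Gap (suc c) ×-↔ ↔-refl)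

  Fin↔Code : Fin dumbbellCount ↔ Code
  Fin↔Code = ↔-trans (*↔× {1 + choose2 (suc a)} {(k + suc b) + (1 + choose2 (suc b))})
                     (Fin↔Gap (suc a) ×-↔ ↔-trans (+↔⊎ {k + suc b} {1 + choose2 (suc b)}) (↔-refl ⊎-↔ Fin↔Gap (suc b)))

  lollipopCount<dumbbellCount : lollipopCount < dumbbellCount
  lollipopCount<dumbbellCount = count-inequality x y k k≤a

  -- Lollipop codes are numbered below lollipopCount and read as dumbbell codes, so the dumbbell code
  -- numbered lollipopCount is never reached.
  widen : LollipopCode → Code
  widen ℓ = Inverse.to Fin↔Code (inject≤ (Inverse.from Fin↔LollipopCode ℓ) (<⇒≤ lollipopCount<dumbbellCount))

  spare : Code
  spare = Inverse.to Fin↔Code (fromℕ< lollipopCount<dumbbellCount)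

  widen-injective : ∀ ℓ ℓ′ → widen ℓ ≡ widen ℓ′ → ℓ ≡ ℓ′
  widen-injective ℓ ℓ′ = Injection.injective (↔⇒↣ (↔-sym Fin↔LollipopCode))
                       ∘ inject≤-injective _ _ _ _
                       ∘ Injection.injective (↔⇒↣ Fin↔Code)

  widen≢spare : ∀ ℓ → widen ℓ ≢ spare
  widen≢spare ℓ e = <-irrefl (sym (trans (sym (toℕ-fromℕ< lollipopCount<dumbbellCount))
                                   (trans (cong toℕ (sym inject≡)) (toℕ-inject≤ _ _))))
                             (toℕ<n (Inverse.from Fin↔LollipopCode ℓ))
    where
      inject≡ = Injection.injective (↔⇒↣ Fin↔Code) e

  embed′ : (z : ConnSub LollipopGraph) (chord : Bool) → edge0 z ≡ chord → ConnSub DumbbellGraph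
  embed′ z false no-chord = Chordless.transport z (chordless-preserved z no-chord)
  embed′ z true  chord    = subgraph (widen (codeOf (chordShape z chord)))

  embed′-chord : ∀ z β e → edge0 (embed′ z β e) ≡ β
  embed′-chord z false e = trans (Chordless.memb-transport z (chordless-preserved z e) 0) e
  embed′-chord z true  e = subgraph-chord₁ (widen (codeOf (chordShape z e)))

  embed′-chord-≡ : ∀ z z′ β β′ e e′ → embed′ z β e ≡ embed′ z′ β′ e′ → β ≡ β′
  embed′-chord-≡ z z′ β β′ e e′ eq =
    trans (sym (embed′-chord z β e)) (trans (cong edge0 eq) (embed′-chord z′ β′ e′))

  embed′-injective : ∀ z z′ β β′ e e′ → embed′ z β e ≡ embed′ z′ β′ e′ → z ≡ z′
  embed′-injective z z′ false false e e′ eq =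
    Chordless.transport-injective z z′ (chordless-preserved z e) (chordless-preserved z′ e′) eq
  embed′-injective z z′ true  true  e e′ eq =
    codeOf-injective (chordShape z e) (chordShape z′ e′) (widen-injective ℓ ℓ′ (subgraph-injective (widen ℓ) (widen ℓ′) eq))
    where
      ℓ = codeOf (chordShape z e)
      ℓ′ = codeOf (chordShape z′ e′)
  embed′-injective z z′ false true  e e′ eq = ⊥-elim (true≢false (sym (embed′-chord-≡ z z′ false true e e′ eq)))
  embed′-injective z z′ true  false e e′ eq = ⊥-elim (true≢false (embed′-chord-≡ z z′ true false e e′ eq))

  embed′≢spare : ∀ z β e → embed′ z β e ≢ subgraph spare
  embed′≢spare z false e eq =
    true≢false (trans (sym (subgraph-chord₁ spare)) (trans (cong edge0 (sym eq)) (embed′-chord z false e)))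
  embed′≢spare z true  e eq = widen≢spare ℓ (subgraph-injective (widen ℓ) spare eq)
    where ℓ = codeOf (chordShape z e)

  embed : ConnSub LollipopGraph → ConnSub DumbbellGraph
  embed z = embed′ z _ refl

  embed-injective : ∀ z z′ → embed z ≡ embed z′ → z ≡ z′
  embed-injective z z′ = embed′-injective z z′ _ _ refl refl

  missed : ConnSub DumbbellGraph
  missed = subgraph spare

  embed≢missed : ∀ z → embed z ≢ missed
  embed≢missed z = embed′≢spare z _ refl

  c<N : c < N
  c<N = <-trans (n<1+n c) c+1<N

  a<N : a < N
  a<N = ≤-<-trans (m≤m+n a k) (+-monoʳ-< a (m<m+n k (s≤s z≤n)))

  module RotateLnk = Transport N N N (LnkEdge c) (lollipopEdge c) ≤-refl (rotate c) (unrotate c)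
                       (λ v → rotate-< c N v c<N) (λ v _ → unrotate∘rotate c v) (λ v _ → rotate∘unrotate c v)

  module UnrotateDumbbell = Transport N (suc N) (suc N) (dumbbellEdge a k b) (CmmEdges.CmmEdge a k b) ≤-refl
                              (unrotate a) (rotate a) (λ v → unrotate-< a N v a<N)
                              (λ v _ → rotate∘unrotate a v) (λ v _ → unrotate∘rotate a v)

  Lnk≡ : ∀ n → n ≡ N → Lnk n (suc k) ≡ tabGraph N (LnkEdge c) N
  Lnk≡ n refl = subst (λ m → Lnk m (suc k) ≡ tabGraph m (LnkEdge c) m) (sym N≡c+1+k+1)
                      (cong (graph (suc c + suc k)) (Lnk-edges c (suc k)))
    where
      N≡c+1+k+1 : N ≡ suc c + suc k
      N≡c+1+k+1 = trans N≡c+2+k (+-suc c (suc k))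

  Cmm-vertices : suc a + suc b + suc k ∸ 2 ≡ N
  Cmm-vertices = identity x y k
    where
      identity : ∀ x y k → suc (x + (3 + y) + suc k) ≡ 2 + x + (k + (3 + y))
      identity = solve-∀

  Cmm≡ : Cmm (suc a) (suc b) (suc k) ≡ tabGraph N (CmmEdges.CmmEdge a k b) (suc N)
  Cmm≡ = cong₂ graph Cmm-vertices (CmmEdges.Cmm-edges a k b)

  rotate-preserves : ∀ T → RotateLnk.Preserves T
  rotate-preserves T t _ _ = sym (rotate-LnkEdge c (s≤s z≤n) t)

  unrotate-preserves : ∀ T → UnrotateDumbbell.Preserves T
  unrotate-preserves T t t≤N _ = unrotate-dumbbellEdge a k b (s≤s z≤n) (s≤s z≤n) t (≤-pred t≤N)

  fromLnk : ∀ n → n ≡ N → ConnSub (Lnk n (suc k)) → ConnSub LollipopGraph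
  fromLnk n n≡N z = RotateLnk.transport w (rotate-preserves (ConnSub.eset w))
    where w = subst ConnSub (Lnk≡ n n≡N) z

  fromLnk-injective : ∀ n n≡N z z′ → fromLnk n n≡N z ≡ fromLnk n n≡N z′ → z ≡ z′
  fromLnk-injective n n≡N z z′ e = subst-injective {P = ConnSub} (Lnk≡ n n≡N)
    (RotateLnk.transport-injective w w′ (rotate-preserves (ConnSub.eset w)) (rotate-preserves (ConnSub.eset w′)) e)
    where
      w  = subst ConnSub (Lnk≡ n n≡N) z
      w′ = subst ConnSub (Lnk≡ n n≡N) z′

  toCmm : ConnSub DumbbellGraph → ConnSub (Cmm (suc a) (suc b) (suc k))
  toCmm z = subst ConnSub (sym Cmm≡)
              (UnrotateDumbbell.transport z (unrotate-preserves (ConnSub.eset z)))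

  toCmm-injective : ∀ z z′ → toCmm z ≡ toCmm z′ → z ≡ z′
  toCmm-injective z z′ =
    UnrotateDumbbell.transport-injective z z′ (unrotate-preserves (ConnSub.eset z)) (unrotate-preserves (ConnSub.eset z′))
    ∘ subst-injective {P = ConnSub} (sym Cmm≡)

lemma4p6 : (m₁ m₂ k n : ℕ) → 3 ≤ m₁ → 3 ≤ m₂ → 1 ≤ k → n ≡ m₁ + m₂ + k ∸ 2 →
    GirthAtLeast (Cmm m₁ m₂ k) k →
    (a b : ℕ) → HasF (Lnk n k) a → HasF (Cmm m₁ m₂ k) b → a < b
lemma4p6 (suc (suc (suc x))) (suc (suc (suc y))) (suc k) n
         3≤m₁@(s≤s (s≤s (s≤s _))) (s≤s (s≤s (s≤s _))) (s≤s _) n≡ girth _ _ F-Lnk F-Cmm =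
  injective-missing⇒< F-Lnk F-Cmm (toCmm ∘ embed ∘ fromLnk n n≡N) injective (toCmm missed) missing
  where
    open LollipopIntoDumbbell x y k (≤-pred (girth⇒k≤m₁ _ _ _ 3≤m₁ girth))
    n≡N = trans n≡ Cmm-vertices
    injective : ∀ z z′ → toCmm (embed (fromLnk n n≡N z)) ≡ toCmm (embed (fromLnk n n≡N z′)) → z ≡ z′
    injective z z′ = fromLnk-injective n n≡N z z′ ∘ embed-injective _ _ ∘ toCmm-injective _ _
    missing : ∀ z → toCmm (embed (fromLnk n n≡N z)) ≢ toCmm missed
    missing z = embed≢missed (fromLnk n n≡N z) ∘ toCmm-injective _ _
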